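{- Let $\lambda=\frac13$. For the proportional majority process, and likewise for the proportional minority process, there exist constants $c>0$ and $k\ge0$ such that for all sufficiently large $n$ there is a graph with at most $n$ vertices, an initial coloring, and a sequence of at least $c\,n^{4/3}/(\log n)^k$ switches such that each switched node is switchable (with respect to the current coloring) at the moment it switches.
   Context: For a coloring of a graph with colors black/white, an edge $\{u,v\}$ is a conflict in the majority process if $u,v$ have different colors, and in the minority process if they have the same color. $N_c(v)$ is the set of neighbors of $v$ joined to $v$ by a conflict. Under the proportional switching rule with parameter $\lambda\in(0,1)$, $v$ is switchable iff $|N_c(v)|\ge\frac{1+\lambda}{2}\deg(v)$; switching flips the color of $v$. The process is sequential: one switchable node switches per step. -}

module Defs where

open import Data.Nat using (ℕ; zero; suc; _+_; _*_; _^_; _≤_; _≥_)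
open import Data.Bool using (Bool; true; false; not; _xor_; T)
open import Data.Fin using (Fin; _≟_)
open import Data.List using (List; []; _∷_; length; filterᵇ; allFin)
open import Data.Unit using (⊤)
open import Data.Product using (_×_)
open import Relation.Nullary using (¬_)
open import Relation.Nullary.Decidable using (⌊_⌋)
open import Relation.Binary.PropositionalEquality using (_≡_)

record Graph (m : ℕ) : Set where
  field
    adj   : Fin m → Fin m → Bool
    sym   : ∀ u v → adj u v ≡ adj v u
    irrefl : ∀ v → adj v v ≡ false

open Graph public

count : ∀ {m} → (Fin m → Bool) → ℕ
count {m} p = length (filterᵇ p (allFin m))

-- colorings: true = black, false = white
Coloring : ℕ → Set
Coloring m = Fin m → Bool

data Process : Set where
  majority minority : Process

conflictColors : Process → Bool → Bool → Bool
conflictColors majority a b = a xor b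
conflictColors minority a b = not (a xor b)

deg : ∀ {m} → Graph m → Fin m → ℕ
deg G v = count (λ u → adj G v u)

conflictDeg : ∀ {m} → Process → Graph m → Coloring m → Fin m → ℕ
conflictDeg P G col v =
  count (λ u → Data.Bool._∧_ (adj G v u) (conflictColors P (col v) (col u)))

-- Proportional switching rule with λ = p / q:
--   |N_c(v)| ≥ (1+λ)/2 · deg(v)   ⇔   2q·|N_c(v)| ≥ (q+p)·deg(v)
Switchable : ℕ → ℕ → ∀ {m} → Process → Graph m → Coloring m → Fin m → Set
Switchable p q P G col v = (q + p) * deg G v ≤ 2 * q * conflictDeg P G col v

switch : ∀ {m} → Coloring m → Fin m → Coloring m
switch col v u = if ⌊ u ≟ v ⌋ then not (col u) else col u
  where open Data.Bool using (if_then_else_)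

ValidRun : ℕ → ℕ → ∀ {m} → Process → Graph m → Coloring m → List (Fin m) → Set
ValidRun p q P G col [] = ⊤
ValidRun p q P G col (v ∷ vs) =
  Switchable p q P G col v × ValidRun p q P G (switch col v) vs

NoIsolated : ∀ {m} → Graph m → Set
NoIsolated G = ∀ v → ¬ (deg G v ≡ 0)

-- The graph is an 8-ary hierarchy of cells on levels 0, …, H.  Every cell consists of
-- 8 groups of vertices, and a group on level l has 8^(H−l) vertices, so n ≈ H · 8^H.
-- A vertex on level l + 1 is joined to 4 of the 8 groups of its parent cell (32 · 8^(H−l−1)
-- vertices) and to 4 · 8^(H−l−1) vertices in its child cells; any 3 of its parent groups
-- give it at least the 2/3 = (1 + λ)/2 of conflicting neighbours needed to switch.
-- A cell runs by flipping its groups in three batches and running all its child cells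
-- between consecutive batches; the batches are chosen so that whenever a group is flipped,
-- three of its four parent groups have the colour opposite to it.  A cell of height h thus
-- makes at least 8 · 16^h switches, and the whole run about 16^H ≈ n^(4/3) / (log n)^(4/3).

module Submission where

open import Defs hiding (sym)
open import Data.Nat using (ℕ; zero; suc; _+_; _*_; _^_; _≤_; _<_; _≥_; _∸_; z≤n; s≤s; _≤ᵇ_; _<ᵇ_; _≡ᵇ_; NonZero; >-nonZero; _≤?_; _<?_)
open import Data.Nat.Properties
open import Data.Nat.DivMod
open import Data.Nat.Logarithm using (⌈log₂_⌉; ⌈log₂⌉-mono-≤; ⌈log₂2^n⌉≡n)
open import Data.Nat.Solver using (module +-*-Solver)
open import Data.Bool using (Bool; true; false; not; _∧_; _∨_; _xor_; T; if_then_else_)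
open import Data.Bool.Properties using (xor-assoc; xor-identityʳ; ∧-zeroʳ; ∧-identityʳ; ∨-comm)
open import Data.Bool.Solver using (module xor-∧-Solver)
open import Data.Fin using (Fin; toℕ; fromℕ<)
open import Data.Fin.Properties using (toℕ<n; toℕ-fromℕ<; toℕ-injective)
import Data.Fin as Fin
open import Data.List using (List; []; _∷_; length; filterᵇ; allFin; tabulate; _++_)
open import Data.List.Properties using (length-++)
open import Data.Unit using (tt)
open import Data.Empty using (⊥; ⊥-elim)
open import Data.Product using (Σ; _×_; _,_; proj₁; proj₂; ∃-syntax)
open import Data.Sum using (inj₁; inj₂)
open import Function using (_∘_)
open import Relation.Nullary using (¬_; yes; no)
open import Relation.Binary.Definitions using (tri<; tri≈; tri>)
open import Relation.Binary.PropositionalEquality using (_≡_; refl; sym; trans; cong; cong₂; subst; subst₂; module ≡-Reasoning)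

≡true⇒T : ∀ {b} → b ≡ true → T b
≡true⇒T refl = tt

T⇒≡true : ∀ {b} → T b → b ≡ true
T⇒≡true {true} _ = refl

T-extensional : ∀ {a b} → (T a → T b) → (T b → T a) → a ≡ b
T-extensional {true}  {true}  f g = refl
T-extensional {true}  {false} f g = ⊥-elim (f tt)
T-extensional {false} {true}  f g = ⊥-elim (g tt)
T-extensional {false} {false} f g = refl

¬T⇒≡false : ∀ {b} → ¬ T b → b ≡ false
¬T⇒≡false {true}  ¬b = ⊥-elim (¬b tt)
¬T⇒≡false {false} _  = refl

T-not⇒≡false : ∀ {b} → T (not b) → b ≡ false
T-not⇒≡false {false} _ = refl

xnor⇒≡ : ∀ {a b} → T (not (a xor b)) → a ≡ b
xnor⇒≡ {true}  {true}  _ = refl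
xnor⇒≡ {false} {false} _ = refl

∧-projˡ : ∀ {a b} → T (a ∧ b) → T a
∧-projˡ {true} _ = tt

∧-projʳ : ∀ {a b} → T (a ∧ b) → T b
∧-projʳ {true} t = t

∧-intro : ∀ {a b} → T a → T b → T (a ∧ b)
∧-intro {true} _ t = t

∨-injˡ : ∀ {a b} → T a → T (a ∨ b)
∨-injˡ {true} _ = tt

∨-injʳ : ∀ {a b} → T b → T (a ∨ b)
∨-injʳ {true}  _ = tt
∨-injʳ {false} t = t

≡ᵇ-refl : ∀ n → (n ≡ᵇ n) ≡ true
≡ᵇ-refl n = T⇒≡true (≡⇒≡ᵇ n n refl)

≢⇒≡ᵇ-false : ∀ {a b} → ¬ a ≡ b → (a ≡ᵇ b) ≡ false
≢⇒≡ᵇ-false {a} {b} a≢b with a ≡ᵇ b in e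
... | true  = ⊥-elim (a≢b (≡ᵇ⇒≡ a b (≡true⇒T e)))
... | false = refl

≤⇒≤ᵇ-true : ∀ {a x} → a ≤ x → (a ≤ᵇ x) ≡ true
≤⇒≤ᵇ-true a≤x = T⇒≡true (≤⇒≤ᵇ a≤x)

>⇒≤ᵇ-false : ∀ {a x} → x < a → (a ≤ᵇ x) ≡ false
>⇒≤ᵇ-false {a} {x} x<a with a ≤ᵇ x in e
... | true  = ⊥-elim (<⇒≱ x<a (≤ᵇ⇒≤ a x (≡true⇒T e)))
... | false = refl

<ᵇ-suc : ∀ t k → (t <ᵇ suc k) ≡ (t <ᵇ k) xor (t ≡ᵇ k)
<ᵇ-suc t k with <-cmp t k
... | tri< t<k _ _ rewrite T⇒≡true (<⇒<ᵇ t<k) | T⇒≡true (<⇒<ᵇ (m<n⇒m<1+n t<k)) | ≢⇒≡ᵇ-false (<⇒≢ t<k) = refl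
... | tri≈ _ refl _ rewrite ≡ᵇ-refl t | >⇒≤ᵇ-false {suc t} {t} ≤-refl | T⇒≡true (<⇒<ᵇ (n<1+n t)) = refl
... | tri> _ _ k<t rewrite >⇒≤ᵇ-false {suc t} {k} (m<n⇒m<1+n k<t) | >⇒≤ᵇ-false {suc t} {suc k} (s≤s k<t) | ≢⇒≡ᵇ-false (λ e → <⇒≢ k<t (sym e)) = refl

bit : Bool → ℕ
bit true  = 1
bit false = 0

countIn : {A : Set} → (A → Bool) → List A → ℕ
countIn p xs = length (filterᵇ p xs)

countIn-∷ : ∀ {A : Set} (p : A → Bool) x xs → countIn p (x ∷ xs) ≡ bit (p x) + countIn p xs
countIn-∷ p x xs with p x
... | true  = refl
... | false = refl

countIn-mono : ∀ {A : Set} (p q : A → Bool) xs → (∀ x → T (p x) → T (q x)) → countIn p xs ≤ countIn q xs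
countIn-mono p q [] p⇒q = z≤n
countIn-mono p q (x ∷ xs) p⇒q rewrite countIn-∷ p x xs | countIn-∷ q x xs with p x in e | q x in e'
... | true  | true  = s≤s (countIn-mono p q xs p⇒q)
... | true  | false = ⊥-elim (subst T e' (p⇒q x (≡true⇒T e)))
... | false | true  = m≤n⇒m≤1+n (countIn-mono p q xs p⇒q)
... | false | false = countIn-mono p q xs p⇒q

countIn-∨-∧ : ∀ {A : Set} (p q : A → Bool) xs →
  countIn (λ x → p x ∨ q x) xs + countIn (λ x → p x ∧ q x) xs ≡ countIn p xs + countIn q xs
countIn-∨-∧ p q [] = refl
countIn-∨-∧ p q (x ∷ xs)
  rewrite countIn-∷ (λ x → p x ∨ q x) x xs | countIn-∷ (λ x → p x ∧ q x) x xs
        | countIn-∷ p x xs | countIn-∷ q x xs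
  with p x | q x
... | true  | true  = cong suc (trans (+-suc _ _) (trans (cong suc (countIn-∨-∧ p q xs)) (sym (+-suc _ _))))
... | true  | false = cong suc (countIn-∨-∧ p q xs)
... | false | true  = trans (cong suc (countIn-∨-∧ p q xs)) (sym (+-suc _ _))
... | false | false = countIn-∨-∧ p q xs

countIn-∨-≤ : ∀ {A : Set} (p q : A → Bool) xs → countIn (λ x → p x ∨ q x) xs ≤ countIn p xs + countIn q xs
countIn-∨-≤ p q xs = ≤-trans (m≤m+n _ _) (≤-reflexive (countIn-∨-∧ p q xs))

countIn-∨-disjoint : ∀ {A : Set} (p q : A → Bool) xs → (∀ x → T (p x) → T (q x) → ⊥) →
  countIn p xs + countIn q xs ≡ countIn (λ x → p x ∨ q x) xs
countIn-∨-disjoint p q xs disjoint = begin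
    countIn p xs + countIn q xs                                        ≡⟨ sym (countIn-∨-∧ p q xs) ⟩
    countIn (λ x → p x ∨ q x) xs + countIn (λ x → p x ∧ q x) xs         ≡⟨ cong (countIn (λ x → p x ∨ q x) xs +_) none ⟩
    countIn (λ x → p x ∨ q x) xs + 0                                   ≡⟨ +-identityʳ _ ⟩
    countIn (λ x → p x ∨ q x) xs                                       ∎
  where
    open ≡-Reasoning
    none : countIn (λ x → p x ∧ q x) xs ≡ 0
    none = n≤0⇒n≡0 (≤-trans (countIn-mono _ (λ _ → false) xs (λ x t → disjoint x (∧-projˡ t) (∧-projʳ {p x} t)))
                            (≤-reflexive (empty xs)))
      where
        empty : ∀ ys → countIn (λ _ → false) ys ≡ 0
        empty []       = refl
        empty (_ ∷ ys) = empty ys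

-- Head recursion, so that shifting the predicate is definitional.
countBelow : (ℕ → Bool) → ℕ → ℕ
countBelow f zero    = 0
countBelow f (suc n) = bit (f 0) + countBelow (f ∘ suc) n

countIn-tabulate : ∀ {A : Set} m (h : Fin m → A) (p : A → Bool) (f : ℕ → Bool) →
  (∀ i → p (h i) ≡ f (toℕ i)) → countIn p (tabulate h) ≡ countBelow f m
countIn-tabulate zero    h p f eq = refl
countIn-tabulate (suc m) h p f eq =
  trans (countIn-∷ p (h Fin.zero) _)
        (cong₂ _+_ (cong bit (eq Fin.zero)) (countIn-tabulate m (h ∘ Fin.suc) p (f ∘ suc) (eq ∘ Fin.suc)))

count-toℕ : ∀ m (f : ℕ → Bool) → count {m} (f ∘ toℕ) ≡ countBelow f m
count-toℕ m f = countIn-tabulate m (λ i → i) (f ∘ toℕ) f (λ _ → refl)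

countBelow-cong : ∀ n f g → (∀ x → x < n → f x ≡ g x) → countBelow f n ≡ countBelow g n
countBelow-cong zero    f g f≗g = refl
countBelow-cong (suc n) f g f≗g =
  cong₂ _+_ (cong bit (f≗g 0 (s≤s z≤n))) (countBelow-cong n (f ∘ suc) (g ∘ suc) (λ x x<n → f≗g (suc x) (s≤s x<n)))

countBelow-+ : ∀ a k f → countBelow f (a + k) ≡ countBelow f a + countBelow (λ x → f (a + x)) k
countBelow-+ zero    k f = refl
countBelow-+ (suc a) k f = trans (cong (bit (f 0) +_) (countBelow-+ a k (f ∘ suc))) (sym (+-assoc (bit (f 0)) _ _))

countBelow-false : ∀ n f → (∀ x → x < n → f x ≡ false) → countBelow f n ≡ 0
countBelow-false n f none = trans (countBelow-cong n f (λ _ → false) none) (constant n)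
  where
    constant : ∀ n → countBelow (λ _ → false) n ≡ 0
    constant zero    = refl
    constant (suc n) = constant n

countBelow-true : ∀ n f → (∀ x → x < n → f x ≡ true) → countBelow f n ≡ n
countBelow-true n f all = trans (countBelow-cong n f (λ _ → true) all) (constant n)
  where
    constant : ∀ n → countBelow (λ _ → true) n ≡ n
    constant zero    = refl
    constant (suc n) = cong suc (constant n)

countBelow-mono : ∀ n k f → countBelow f n ≤ countBelow f (n + k)
countBelow-mono n k f = ≤-trans (m≤m+n _ _) (≤-reflexive (sym (countBelow-+ n k f)))

inRange : ℕ → ℕ → ℕ → Bool
inRange a s x = (a ≤ᵇ x) ∧ (x <ᵇ a + s)

inRange-intro : ∀ a s x → a ≤ x → x < a + s → T (inRange a s x)
inRange-intro a s x a≤x x<a+s rewrite ≤⇒≤ᵇ-true a≤x = <⇒<ᵇ x<a+s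

inRange-lower : ∀ a s x → T (inRange a s x) → a ≤ x
inRange-lower a s x t = ≤ᵇ⇒≤ a x (∧-projˡ t)

inRange-upper : ∀ a s x → T (inRange a s x) → x < a + s
inRange-upper a s x t = <ᵇ⇒< x (a + s) (∧-projʳ {a ≤ᵇ x} t)

inRange-below : ∀ a s x → x < a → inRange a s x ≡ false
inRange-below a s x x<a rewrite >⇒≤ᵇ-false x<a = refl

inRange-shift : ∀ a s x → inRange a s (a + x) ≡ (x <ᵇ s)
inRange-shift a s x rewrite ≤⇒≤ᵇ-true (m≤m+n a x) = lemma a
  where
    lemma : ∀ a → (suc (a + x) ≤ᵇ a + s) ≡ (suc x ≤ᵇ s)
    lemma zero    = refl
    lemma (suc a) = lemma a

inRange-empty : ∀ a x → inRange a 0 x ≡ false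
inRange-empty a x with a ≤ᵇ x in e
... | false = refl
... | true  = >⇒≤ᵇ-false (s≤s (≤-trans (≤-reflexive (+-identityʳ a)) (≤ᵇ⇒≤ a x (≡true⇒T e))))

inRange-suc : ∀ a s x → inRange a (suc s) x ≡ (x ≡ᵇ a) xor inRange (suc a) s x
inRange-suc a s x with <-cmp x a
... | tri< x<a _ _ rewrite inRange-below a (suc s) x x<a | ≢⇒≡ᵇ-false (<⇒≢ x<a)
                         | inRange-below (suc a) s x (m<n⇒m<1+n x<a) = refl
... | tri≈ _ refl _ rewrite ≡ᵇ-refl x | inRange-below (suc x) s x ≤-refl
                          = T⇒≡true (inRange-intro x (suc s) x ≤-refl (m<m+n x (s≤s z≤n)))
... | tri> _ _ a<x rewrite ≤⇒≤ᵇ-true (<⇒≤ a<x) | ≤⇒≤ᵇ-true a<x | ≢⇒≡ᵇ-false (<⇒≢ a<x ∘ sym)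
                         | +-suc a s = refl

inRange-suc-false : ∀ a s x → inRange a (suc s) x ≡ false → (x ≡ᵇ a) ≡ false × inRange (suc a) s x ≡ false
inRange-suc-false a s x x∉ with x Data.Nat.≟ a
... | yes refl = ⊥-elim (subst T x∉ (inRange-intro x (suc s) x ≤-refl (m<m+n x (s≤s z≤n))))
... | no x≢a   = ≢⇒≡ᵇ-false x≢a , trans (sym (trans (inRange-suc a s x) (cong (_xor inRange (suc a) s x) (≢⇒≡ᵇ-false x≢a)))) x∉

countBelow-inRange : ∀ a s n → a + s ≤ n → countBelow (inRange a s) n ≡ s
countBelow-inRange a s n a+s≤n = begin
    countBelow (inRange a s) n                          ≡⟨ cong (countBelow (inRange a s)) (sym n≡) ⟩
    countBelow (inRange a s) (a + (s + k))              ≡⟨ countBelow-+ a (s + k) (inRange a s) ⟩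
    countBelow (inRange a s) a + countBelow (λ x → inRange a s (a + x)) (s + k)
      ≡⟨ cong₂ _+_ (countBelow-false a _ (inRange-below a s)) (countBelow-cong (s + k) _ _ (λ x _ → inRange-shift a s x)) ⟩
    countBelow (_<ᵇ s) (s + k)                          ≡⟨ countBelow-+ s k (_<ᵇ s) ⟩
    countBelow (_<ᵇ s) s + countBelow (λ x → s + x <ᵇ s) k
      ≡⟨ cong₂ _+_ (countBelow-true s _ (λ x x<s → T⇒≡true (<⇒<ᵇ x<s)))
                   (countBelow-false k _ (λ x _ → >⇒≤ᵇ-false (s≤s (m≤m+n s x)))) ⟩
    s + 0                                               ≡⟨ +-identityʳ s ⟩
    s                                                   ∎
  where
    open ≡-Reasoning
    k = n ∸ (a + s)
    n≡ : a + (s + k) ≡ n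
    n≡ = trans (sym (+-assoc a s k)) (m+[n∸m]≡n a+s≤n)

count-inRange : ∀ m a s → a + s ≤ m → count {m} (inRange a s ∘ toℕ) ≡ s
count-inRange m a s a+s≤m = trans (count-toℕ m (inRange a s)) (countBelow-inRange a s m a+s≤m)

count-inRange-≤ : ∀ m a s → count {m} (inRange a s ∘ toℕ) ≤ s
count-inRange-≤ m a s = begin
    count {m} (inRange a s ∘ toℕ)                ≡⟨ count-toℕ m (inRange a s) ⟩
    countBelow (inRange a s) m                   ≤⟨ countBelow-mono m (a + s) (inRange a s) ⟩
    countBelow (inRange a s) (m + (a + s))       ≡⟨ countBelow-inRange a s _ (m≤n+m (a + s) m) ⟩
    s                                            ∎
  where open ≤-Reasoning

anyBelow : ℕ → (ℕ → ℕ → Bool) → ℕ → Bool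
anyBelow zero    f x = false
anyBelow (suc k) f x = anyBelow k f x ∨ f k x

anyBelow-intro : ∀ k f x t → t < k → T (f t x) → T (anyBelow k f x)
anyBelow-intro (suc k) f x t t<1+k ft with m≤n⇒m<n∨m≡n (≤-pred t<1+k)
... | inj₁ t<k  = ∨-injˡ (anyBelow-intro k f x t t<k ft)
... | inj₂ refl = ∨-injʳ {anyBelow k f x} ft

anyBelow-elim : ∀ k f x → T (anyBelow k f x) → ∃[ t ] (t < k × T (f t x))
anyBelow-elim (suc k) f x any with anyBelow k f x in e
... | true  = let (t , t<k , ft) = anyBelow-elim k f x (≡true⇒T e) in t , m<n⇒m<1+n t<k , ft
... | false = k , ≤-refl , any

sumBelow : ℕ → (ℕ → ℕ) → ℕ
sumBelow zero    g = 0
sumBelow (suc k) g = sumBelow k g + g k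

sumBelow-≤ : ∀ k g c → (∀ t → t < k → g t ≤ c) → sumBelow k g ≤ k * c
sumBelow-≤ zero    g c bound = z≤n
sumBelow-≤ (suc k) g c bound =
  ≤-trans (+-mono-≤ (sumBelow-≤ k g c (λ t t<k → bound t (m<n⇒m<1+n t<k))) (bound k ≤-refl))
          (≤-reflexive (+-comm (k * c) c))

sumBelow-≥ : ∀ k g c → (∀ t → t < k → c ≤ g t) → k * c ≤ sumBelow k g
sumBelow-≥ zero    g c bound = z≤n
sumBelow-≥ (suc k) g c bound =
  ≤-trans (≤-reflexive (+-comm c (k * c)))
          (+-mono-≤ (sumBelow-≥ k g c (λ t t<k → bound t (m<n⇒m<1+n t<k))) (bound k ≤-refl))

sumBelow-skip : ∀ k g c s → s < k → (∀ t → t < k → ¬ t ≡ s → c ≤ g t) → (k ∸ 1) * c ≤ sumBelow k g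
sumBelow-skip (suc k) g c s s<1+k bound with m≤n⇒m<n∨m≡n (≤-pred s<1+k)
... | inj₂ refl = ≤-trans (sumBelow-≥ k g c (λ t t<k → bound t (m<n⇒m<1+n t<k) (<⇒≢ t<k))) (m≤m+n _ _)
... | inj₁ s<k@(s≤s {n = k-1} _) =
  ≤-trans (≤-reflexive (+-comm c (k-1 * c)))
          (+-mono-≤ (sumBelow-skip (suc k-1) g c s s<k (λ t t<k → bound t (m<n⇒m<1+n t<k)))
                    (bound (suc k-1) ≤-refl (<⇒≢ s<k ∘ sym)))

count-anyBelow-≤ : ∀ m k f → count {m} (anyBelow k f ∘ toℕ) ≤ sumBelow k (λ t → count {m} (f t ∘ toℕ))
count-anyBelow-≤ m zero    f = ≤-reflexive (trans (count-toℕ m _) (countBelow-false m _ (λ _ _ → refl)))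
count-anyBelow-≤ m (suc k) f =
  ≤-trans (countIn-∨-≤ (anyBelow k f ∘ toℕ) (f k ∘ toℕ) (allFin m)) (+-monoˡ-≤ _ (count-anyBelow-≤ m k f))

count-covered-by-intervals : ∀ m k (p : Fin m → Bool) (from : ℕ → ℕ) s →
  (∀ u → T (p u) → ∃[ t ] (t < k × T (inRange (from t) s (toℕ u)))) → count p ≤ k * s
count-covered-by-intervals m k p from s covered = begin
    count p                                                   ≤⟨ countIn-mono p (anyBelow k intervals ∘ toℕ) (allFin m) in-union ⟩
    count {m} (anyBelow k intervals ∘ toℕ)                    ≤⟨ count-anyBelow-≤ m k intervals ⟩
    sumBelow k (λ t → count {m} (intervals t ∘ toℕ))          ≤⟨ sumBelow-≤ k _ s (λ t _ → count-inRange-≤ m (from t) s) ⟩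
    k * s                                                     ∎
  where
    open ≤-Reasoning
    intervals : ℕ → ℕ → Bool
    intervals t = inRange (from t) s
    in-union : ∀ u → T (p u) → T (anyBelow k intervals (toℕ u))
    in-union u pu = let (t , t<k , u∈) = covered u pu in anyBelow-intro k intervals (toℕ u) t t<k u∈

count-anyBelow-disjoint : ∀ m k f → (∀ t t' x → t < t' → t' < k → T (f t x) → T (f t' x) → ⊥) →
  sumBelow k (λ t → count {m} (f t ∘ toℕ)) ≡ count {m} (anyBelow k f ∘ toℕ)
count-anyBelow-disjoint m zero    f disjoint = sym (trans (count-toℕ m _) (countBelow-false m _ (λ _ _ → refl)))
count-anyBelow-disjoint m (suc k) f disjoint =
  trans (cong (_+ count {m} (f k ∘ toℕ)) (count-anyBelow-disjoint m k f (λ t t' x t<t' t'<k → disjoint t t' x t<t' (m<n⇒m<1+n t'<k))))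
        (countIn-∨-disjoint (anyBelow k f ∘ toℕ) (f k ∘ toℕ) (allFin m) last)
  where
    last : ∀ u → T (anyBelow k f (toℕ u)) → T (f k (toℕ u)) → ⊥
    last u earlier now = let (t , t<k , ft) = anyBelow-elim k f (toℕ u) earlier in disjoint t k (toℕ u) t<k ≤-refl ft now

allBelow : ℕ → (ℕ → Bool) → Bool
allBelow zero    f = true
allBelow (suc n) f = allBelow n f ∧ f n

allBelow-sound : ∀ n f → T (allBelow n f) → ∀ k → k < n → T (f k)
allBelow-sound (suc n) f all k k<1+n with m≤n⇒m<n∨m≡n (≤-pred k<1+n)
... | inj₁ k<n  = allBelow-sound n f (∧-projˡ all) k k<n
... | inj₂ refl = ∧-projʳ {allBelow n f} all

applyRun : ∀ {m} → Coloring m → List (Fin m) → Coloring m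
applyRun col []       = col
applyRun col (v ∷ vs) = applyRun (switch col v) vs

applyRun-++ : ∀ {m} (col : Coloring m) xs ys → applyRun col (xs ++ ys) ≡ applyRun (applyRun col xs) ys
applyRun-++ col []       ys = refl
applyRun-++ col (x ∷ xs) ys = applyRun-++ (switch col x) xs ys

switch-xor : ∀ {m} (col : Coloring m) v u → switch col v u ≡ col u xor (toℕ u ≡ᵇ toℕ v)
switch-xor col v u with u Fin.≟ v
... | yes refl rewrite ≡ᵇ-refl (toℕ u) with col u
...   | true  = refl
...   | false = refl
switch-xor col v u | no u≢v rewrite ≢⇒≡ᵇ-false (u≢v ∘ toℕ-injective) = sym (xor-identityʳ (col u))

intervalRun : ∀ {m} a s → a + s ≤ m → List (Fin m)
intervalRun a zero    _     = []
intervalRun a (suc s) a+s≤m =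
  fromℕ< (≤-trans (m<m+n a (s≤s z≤n)) a+s≤m) ∷ intervalRun (suc a) s (≤-trans (≤-reflexive (sym (+-suc a s))) a+s≤m)

intervalRun-length : ∀ {m} a s (a+s≤m : a + s ≤ m) → length (intervalRun a s a+s≤m) ≡ s
intervalRun-length a zero    _ = refl
intervalRun-length a (suc s) _ = cong suc (intervalRun-length (suc a) s _)

module Runs {m} (p q : ℕ) (P : Process) (G : Graph m) where

  Flips : Coloring m → List (Fin m) → (ℕ → Bool) → Set
  Flips col L f = ValidRun p q P G col L × (∀ x → applyRun col L x ≡ col x xor f (toℕ x))

  Flips-cong : ∀ {col L} f g → (∀ (x : Fin m) → f (toℕ x) ≡ g (toℕ x)) → Flips col L f → Flips col L g
  Flips-cong {col} f g f≗g (valid , effect) = valid , λ x → trans (effect x) (cong (col x xor_) (f≗g x))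

  Flips-++ : ∀ {col} L₁ L₂ f₁ f₂ → Flips col L₁ f₁ →
    (∀ col' → (∀ x → col' x ≡ col x xor f₁ (toℕ x)) → Flips col' L₂ f₂) →
    Flips col (L₁ ++ L₂) (λ z → f₁ z xor f₂ z)
  Flips-++ {col} L₁ L₂ f₁ f₂ (valid₁ , effect₁) continue =
    valid-++ col L₁ valid₁ valid₂ ,
    λ x → trans (cong (λ c → c x) (applyRun-++ col L₁ L₂))
         (trans (effect₂ x) (trans (cong (_xor f₂ (toℕ x)) (effect₁ x)) (xor-assoc (col x) _ _)))
    where
      valid₂ = proj₁ (continue (applyRun col L₁) effect₁)
      effect₂ = proj₂ (continue (applyRun col L₁) effect₁)
      valid-++ : ∀ col xs → ValidRun p q P G col xs → ValidRun p q P G (applyRun col xs) L₂ → ValidRun p q P G col (xs ++ L₂)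
      valid-++ col []       _             valid = valid
      valid-++ col (x ∷ xs) (sw , validₓ) valid = sw , valid-++ (switch col x) xs validₓ valid

  -- Insensitive to the switches made inside the interval, so that it can be run through.
  StablySwitchable : ℕ → ℕ → Coloring m → Set
  StablySwitchable a s col = ∀ (col' : Coloring m) (y : Fin m) → T (inRange a s (toℕ y)) →
    (∀ x → inRange a s (toℕ x) ≡ false → col' x ≡ col x) → col' y ≡ col y → Switchable p q P G col' y

  intervalRun-flips : ∀ a s (a+s≤m : a + s ≤ m) col → StablySwitchable a s col →
    Flips col (intervalRun a s a+s≤m) (inRange a s)
  intervalRun-flips a zero    a+s≤m col stable = tt , λ x → sym (trans (cong (col x xor_) (inRange-empty a (toℕ x))) (xor-identityʳ _))
  intervalRun-flips a (suc s) a+s≤m col stable = (first-switchable , proj₁ rest) , effect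
    where
      v = fromℕ< (≤-trans (m<m+n a (s≤s z≤n)) a+s≤m)
      switch-v : ∀ x → switch col v x ≡ col x xor (toℕ x ≡ᵇ a)
      switch-v x = trans (switch-xor col v x) (cong (λ b → col x xor (toℕ x ≡ᵇ b)) (toℕ-fromℕ< _))
      switch-v-other : ∀ x → (toℕ x ≡ᵇ a) ≡ false → switch col v x ≡ col x
      switch-v-other x x≢a = trans (switch-v x) (trans (cong (col x xor_) x≢a) (xor-identityʳ _))
      first-switchable : Switchable p q P G col v
      first-switchable = stable col v (subst (T ∘ inRange a (suc s)) (sym (toℕ-fromℕ< _)) (inRange-intro a (suc s) a ≤-refl (m<m+n a (s≤s z≤n))))
                                (λ _ _ → refl) refl
      stable-after : StablySwitchable (suc a) s (switch col v)
      stable-after col' y y∈ agree col'y = stable col' y y∈' agree' (trans col'y (switch-v-other y y≢a))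
        where
          y≢a : (toℕ y ≡ᵇ a) ≡ false
          y≢a = ≢⇒≡ᵇ-false (<⇒≢ (inRange-lower (suc a) s (toℕ y) y∈) ∘ sym)
          y∈' : T (inRange a (suc s) (toℕ y))
          y∈' = subst T (sym (trans (inRange-suc a s (toℕ y)) (cong (_xor inRange (suc a) s (toℕ y)) y≢a))) y∈
          agree' : ∀ x → inRange a (suc s) (toℕ x) ≡ false → col' x ≡ col x
          agree' x x∉ = trans (agree x (proj₂ split)) (switch-v-other x (proj₁ split))
            where split = inRange-suc-false a s (toℕ x) x∉
      rest = intervalRun-flips (suc a) s _ (switch col v) stable-after
      effect : ∀ x → applyRun (switch col v) (intervalRun (suc a) s _) x ≡ col x xor inRange a (suc s) (toℕ x)
      effect x = begin
          applyRun (switch col v) (intervalRun (suc a) s _) x     ≡⟨ proj₂ rest x ⟩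
          switch col v x xor inRange (suc a) s (toℕ x)           ≡⟨ cong (_xor _) (switch-v x) ⟩
          (col x xor (toℕ x ≡ᵇ a)) xor inRange (suc a) s (toℕ x) ≡⟨ xor-assoc (col x) _ _ ⟩
          col x xor ((toℕ x ≡ᵇ a) xor inRange (suc a) s (toℕ x)) ≡⟨ cong (col x xor_) (sym (inRange-suc a s (toℕ x))) ⟩
          col x xor inRange a (suc s) (toℕ x)                    ∎
        where open ≡-Reasoning

%-unique : ∀ n .{{_ : NonZero n}} q r x → r < n → x ≡ r + q * n → x % n ≡ r
%-unique n q r x r<n x≡ = trans (cong (_% n) x≡) (trans ([m+kn]%n≡m%n r q n) (m<n⇒m%n≡m r<n))

/-unique : ∀ n .{{_ : NonZero n}} q r x → r < n → x ≡ r + q * n → x / n ≡ q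
/-unique n q r x r<n x≡ = sym (*-cancelʳ-≡ q (x / n) n (+-cancelˡ-≡ r _ _ (begin
    r + q * n          ≡⟨ sym x≡ ⟩
    x                  ≡⟨ m≡m%n+[m/n]*n x n ⟩
    x % n + x / n * n  ≡⟨ cong (_+ x / n * n) (%-unique n q r x r<n x≡) ⟩
    r + x / n * n      ∎)))
  where open ≡-Reasoning

[8a+k]/8≡a : ∀ a k → k < 8 → (8 * a + k) / 8 ≡ a
[8a+k]/8≡a a k k<8 = /-unique 8 a k (8 * a + k) k<8 (trans (+-comm (8 * a) k) (cong (k +_) (*-comm 8 a)))

[8a+k]%8≡k : ∀ a k → k < 8 → (8 * a + k) % 8 ≡ k
[8a+k]%8≡k a k k<8 = %-unique 8 a k (8 * a + k) k<8 (trans (+-comm (8 * a) k) (cong (k +_) (*-comm 8 a)))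

8a+k<8^[1+l] : ∀ a k l → a < 8 ^ l → k < 8 → 8 * a + k < 8 ^ suc l
8a+k<8^[1+l] a k l a< k<8 = begin-strict
    8 * a + k  <⟨ +-monoʳ-< (8 * a) k<8 ⟩
    8 * a + 8  ≡⟨ trans (+-comm (8 * a) 8) (sym (*-suc 8 a)) ⟩
    8 * suc a  ≤⟨ *-monoʳ-≤ 8 a< ⟩
    8 ^ suc l  ∎
  where open ≤-Reasoning

a≡8[a/8]+a%8 : ∀ a → a ≡ 8 * (a / 8) + a % 8
a≡8[a/8]+a%8 a = trans (m≡m%n+[m/n]*n a 8) (trans (+-comm (a % 8) _) (cong (_+ a % 8) (*-comm (a / 8) 8)))

≡ᵇ-8c+k : ∀ a c k → k < 8 → (a ≡ᵇ 8 * c + k) ≡ (a / 8 ≡ᵇ c) ∧ (a % 8 ≡ᵇ k)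
≡ᵇ-8c+k a c k k<8 = T-extensional to from
  where
    to : T (a ≡ᵇ 8 * c + k) → T ((a / 8 ≡ᵇ c) ∧ (a % 8 ≡ᵇ k))
    to a≡ = let a≡′ = ≡ᵇ⇒≡ a (8 * c + k) a≡ in
      ∧-intro (≡⇒≡ᵇ (a / 8) c (trans (cong (_/ 8) a≡′) ([8a+k]/8≡a c k k<8)))
              (≡⇒≡ᵇ (a % 8) k (trans (cong (_% 8) a≡′) ([8a+k]%8≡k c k k<8)))
    from : T ((a / 8 ≡ᵇ c) ∧ (a % 8 ≡ᵇ k)) → T (a ≡ᵇ 8 * c + k)
    from both = ≡⇒≡ᵇ a (8 * c + k) (trans (a≡8[a/8]+a%8 a)
      (cong₂ (λ q r → 8 * q + r) (≡ᵇ⇒≡ (a / 8) c (∧-projˡ both)) (≡ᵇ⇒≡ (a % 8) k (∧-projʳ {a / 8 ≡ᵇ c} both))))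

-- Vertices are the numbers below (H + 1) · 8^(H+1).  Vertex x lies on level x / 8^(H+1);
-- each level is cut into 8^(l+1) consecutive groups of size 8^(H-l), and group g is the
-- group of kind g % 8 of the cell g / 8.  Cell c of level l + 1 is a child of cell c / 8.
module Construction (H : ℕ) where

  8^-nonZero : ∀ k → NonZero (8 ^ k)
  8^-nonZero k = m^n≢0 8 k

  _/8^_ : ℕ → ℕ → ℕ
  x /8^ k = _/_ x (8 ^ k) {{8^-nonZero k}}

  _%8^_ : ℕ → ℕ → ℕ
  x %8^ k = _%_ x (8 ^ k) {{8^-nonZero k}}

  width : ℕ
  width = 8 ^ suc H

  order : ℕ
  order = suc H * width

  groupSize : ℕ → ℕ
  groupSize l = 8 ^ (H ∸ l)

  level offset group kind cell : ℕ → ℕ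
  level x  = x /8^ suc H
  offset x = x %8^ suc H
  group x  = offset x /8^ (H ∸ level x)
  kind x   = group x % 8
  cell x   = group x / 8

  groupSize-pos : ∀ l → 1 ≤ groupSize l
  groupSize-pos l = m^n>0 8 (H ∸ l)

  groupSize-suc : ∀ l → l < H → groupSize l ≡ 8 * groupSize (suc l)
  groupSize-suc l l<H = cong (8 ^_) (+-∸-assoc 1 l<H)

  groups*groupSize≡width : ∀ l → l ≤ H → 8 ^ suc l * groupSize l ≡ width
  groups*groupSize≡width l l≤H = trans (sym (^-distribˡ-+-* 8 (suc l) (H ∸ l))) (cong (λ e → 8 ^ suc e) (m+[n∸m]≡n l≤H))

  level≤H : ∀ x → x < order → level x ≤ H
  level≤H x x<order = ≤-pred (m<n*o⇒m/o<n {x} {suc H} {width} {{8^-nonZero (suc H)}} x<order)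

  group< : ∀ x → level x ≤ H → group x < 8 ^ suc (level x)
  group< x l≤H = m<n*o⇒m/o<n {offset x} {8 ^ suc (level x)} {groupSize (level x)} {{8^-nonZero (H ∸ level x)}}
    (subst (offset x <_) (sym (groups*groupSize≡width (level x) l≤H)) (m%n<n x width {{8^-nonZero (suc H)}}))

  kind<8 : ∀ x → kind x < 8
  kind<8 x = m%n<n (group x) 8

  group≡8cell+kind : ∀ x → group x ≡ 8 * cell x + kind x
  group≡8cell+kind x = a≡8[a/8]+a%8 (group x)

  parentCell< : ∀ y l → level y ≡ suc l → level y ≤ H → cell y / 8 < 8 ^ l
  parentCell< y l level≡ l≤H = m<n*o⇒m/o<n {cell y} {8 ^ l} {8} (subst (cell y <_) (*-comm 8 (8 ^ l))
    (m<n*o⇒m/o<n {group y} {8 ^ suc l} {8} (subst (group y <_) (*-comm 8 (8 ^ suc l)) (subst (λ e → group y < 8 ^ suc e) level≡ (group< y l≤H)))))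

  ancestor : ℕ → ℕ → ℕ
  ancestor z j = cell z /8^ (level z ∸ j)

  /8^-suc : ∀ a e → a /8^ suc e ≡ (a /8^ e) / 8
  /8^-suc a e = trans (/-congʳ {{8^-nonZero (suc e)}} {{m*n≢0 (8 ^ e) 8 {{8^-nonZero e}}}} (*-comm 8 (8 ^ e)))
                      (sym (m/n/o≡m/[n*o] a (8 ^ e) 8 {{8^-nonZero e}} {{_}} {{m*n≢0 (8 ^ e) 8 {{8^-nonZero e}}}}))

  ancestor-self : ∀ z → ancestor z (level z) ≡ cell z
  ancestor-self z = trans (cong (cell z /8^_) (n∸n≡0 (level z))) (n/1≡n (cell z))

  ancestor-step : ∀ z j → suc j ≤ level z → ancestor z j ≡ ancestor z (suc j) / 8
  ancestor-step z j j<level = trans (cong (cell z /8^_) (+-∸-assoc 1 j<level)) (/8^-suc (cell z) (level z ∸ suc j))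

  vertex-decomposition : ∀ x → x ≡ level x * width + (group x * groupSize (level x) + offset x %8^ (H ∸ level x))
  vertex-decomposition x = begin
      x                                                      ≡⟨ m≡m%n+[m/n]*n x width {{8^-nonZero (suc H)}} ⟩
      offset x + level x * width                             ≡⟨ +-comm (offset x) _ ⟩
      level x * width + offset x
        ≡⟨ cong (level x * width +_) (trans (m≡m%n+[m/n]*n (offset x) (groupSize (level x)) {{8^-nonZero (H ∸ level x)}}) (+-comm (offset x %8^ (H ∸ level x)) (group x * groupSize (level x)))) ⟩
      level x * width + (group x * groupSize (level x) + offset x %8^ (H ∸ level x)) ∎
    where open ≡-Reasoning

  groupStart : ℕ → ℕ → ℕ
  groupStart l g = l * width + g * groupSize l

  inGroup : ℕ → ℕ → ℕ → Bool
  inGroup l g = inRange (groupStart l g) (groupSize l)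

  group-fits : ∀ l g → l ≤ H → g < 8 ^ suc l → groupStart l g + groupSize l ≤ order
  group-fits l g l≤H g< = begin
      l * width + g * groupSize l + groupSize l     ≡⟨ +-assoc (l * width) _ _ ⟩
      l * width + (g * groupSize l + groupSize l)   ≡⟨ cong (l * width +_) (+-comm (g * groupSize l) _) ⟩
      l * width + suc g * groupSize l               ≤⟨ +-monoʳ-≤ (l * width) (*-monoˡ-≤ (groupSize l) g<) ⟩
      l * width + 8 ^ suc l * groupSize l           ≡⟨ cong (l * width +_) (groups*groupSize≡width l l≤H) ⟩
      l * width + width                             ≡⟨ +-comm (l * width) width ⟩
      suc l * width                                 ≤⟨ *-monoˡ-≤ width (s≤s l≤H) ⟩
      order                                         ∎
    where open ≤-Reasoning

  inGroup⇒level-group : ∀ l g x → l ≤ H → g < 8 ^ suc l → T (inGroup l g x) → level x ≡ l × group x ≡ g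
  inGroup⇒level-group l g x l≤H g< x∈ = level≡ , group≡
    where
      s = groupSize l
      r = x ∸ (l * width + g * s)
      r<s : r < s
      r<s = m<n+o⇒m∸n<o x _ {{8^-nonZero (H ∸ l)}} (inRange-upper (l * width + g * s) s x x∈)
      x≡ : x ≡ (g * s + r) + l * width
      x≡ = trans (sym (m+[n∸m]≡n (inRange-lower (l * width + g * s) s x x∈))) (trans (+-assoc (l * width) (g * s) r) (+-comm (l * width) _))
      offset< : g * s + r < width
      offset< = begin-strict
          g * s + r    <⟨ +-monoʳ-< (g * s) r<s ⟩
          g * s + s    ≡⟨ +-comm (g * s) s ⟩
          suc g * s    ≤⟨ *-monoˡ-≤ s g< ⟩
          8 ^ suc l * s ≡⟨ groups*groupSize≡width l l≤H ⟩
          width        ∎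
        where open ≤-Reasoning
      level≡ : level x ≡ l
      level≡ = /-unique width {{8^-nonZero (suc H)}} l (g * s + r) x offset< x≡
      group≡ : group x ≡ g
      group≡ = trans (cong (λ e → offset x /8^ (H ∸ e)) level≡)
        (/-unique s {{8^-nonZero (H ∸ l)}} g r (offset x) r<s
          (trans (%-unique width {{8^-nonZero (suc H)}} l (g * s + r) x offset< x≡) (+-comm (g * s) r)))

  inGroup⇒level-cell-kind : ∀ l c κ x → l ≤ H → c < 8 ^ l → κ < 8 → T (inGroup l (8 * c + κ) x) →
    level x ≡ l × cell x ≡ c × kind x ≡ κ
  inGroup⇒level-cell-kind l c κ x l≤H c< κ<8 x∈ =
    proj₁ lg , trans (cong (_/ 8) (proj₂ lg)) ([8a+k]/8≡a c κ κ<8) , trans (cong (_% 8) (proj₂ lg)) ([8a+k]%8≡k c κ κ<8)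
    where lg = inGroup⇒level-group l (8 * c + κ) x l≤H (8a+k<8^[1+l] c κ l c< κ<8) x∈

  inGroups-range : ∀ x g k → g ≤ group x → group x < g + k →
    T (inRange (level x * width + g * groupSize (level x)) (k * groupSize (level x)) x)
  inGroups-range x g k g≤ <g+k = inRange-intro _ _ x lower upper
    where
      s = groupSize (level x)
      a = level x * width
      own-lower : a + group x * s ≤ x
      own-lower = ≤-trans (m≤m+n (a + group x * s) _) (≤-reflexive (trans (+-assoc a _ _) (sym (vertex-decomposition x))))
      lower : a + g * s ≤ x
      lower = ≤-trans (+-monoʳ-≤ a (*-monoˡ-≤ s g≤)) own-lower
      upper : x < a + g * s + k * s
      upper = begin-strict
          x                             ≡⟨ vertex-decomposition x ⟩
          a + (group x * s + _)         <⟨ +-monoʳ-< a (+-monoʳ-< (group x * s) (m%n<n (offset x) s {{8^-nonZero (H ∸ level x)}})) ⟩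
          a + (group x * s + s)         ≡⟨ cong (a +_) (+-comm (group x * s) s) ⟩
          a + suc (group x) * s         ≤⟨ +-monoʳ-≤ a (*-monoˡ-≤ s <g+k) ⟩
          a + (g + k) * s               ≡⟨ trans (cong (a +_) (*-distribʳ-+ s g k)) (sym (+-assoc a _ _)) ⟩
          a + g * s + k * s             ∎
        where open ≤-Reasoning

  inGroup-own : ∀ x → T (inGroup (level x) (group x) x)
  inGroup-own x = subst (λ s → T (inRange (level x * width + group x * groupSize (level x)) s x)) (*-identityˡ _) (inGroups-range x (group x) 1 ≤-refl (≤-reflexive (+-comm 1 (group x))))

  parentKind : ℕ → ℕ → ℕ
  parentKind κ 0 = if 4 ≤ᵇ κ then 4 else 0
  parentKind κ 1 = if 4 ≤ᵇ κ then 5 else 1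
  parentKind κ 2 = if 4 ≤ᵇ κ then 2 else 6
  parentKind κ _ = if 4 ≤ᵇ κ then 3 else 7

  isParentKind : ℕ → ℕ → Bool
  isParentKind κ = anyBelow 4 (λ i k → parentKind κ i ≡ᵇ k)

  firstChildKind : ℕ → ℕ
  firstChildKind κ = if (κ ≡ᵇ 0) ∨ (κ ≡ᵇ 1) ∨ (κ ≡ᵇ 6) ∨ (κ ≡ᵇ 7) then 0 else 4

  parentGroup : ℕ → ℕ → ℕ
  parentGroup y i = 8 * (cell y / 8) + parentKind (kind y) i

  kindTable : (ℕ → ℕ → Bool) → Bool
  kindTable f = allBelow 8 (λ κ → allBelow 4 (f κ))

  kindTable-sound : ∀ f → T (kindTable f) → ∀ κ i → κ < 8 → i < 4 → T (f κ i)
  kindTable-sound f table κ i κ<8 i<4 = allBelow-sound 4 (f κ) (allBelow-sound 8 (λ κ → allBelow 4 (f κ)) table κ κ<8) i i<4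

  parentKind<8 : ∀ κ i → κ < 8 → i < 4 → parentKind κ i < 8
  parentKind<8 κ i κ<8 i<4 = <ᵇ⇒< _ 8 (kindTable-sound (λ κ i → parentKind κ i <ᵇ 8) tt κ i κ<8 i<4)

  parentKind-injective : ∀ κ i i' → κ < 8 → i < 4 → i' < 4 → parentKind κ i ≡ parentKind κ i' → i ≡ i'
  parentKind-injective κ i i' κ<8 i<4 i'<4 same =
    ≡ᵇ⇒≡ i i' (modus-ponens (≡⇒≡ᵇ _ _ same) (allBelow-sound 4 (λ i' → not (parentKind κ i ≡ᵇ parentKind κ i') ∨ (i ≡ᵇ i')) (kindTable-sound check tt κ i κ<8 i<4) i' i'<4))
    where
      check : ℕ → ℕ → Bool
      check κ i = allBelow 4 (λ i' → not (parentKind κ i ≡ᵇ parentKind κ i') ∨ (i ≡ᵇ i'))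
      modus-ponens : ∀ {a b} → T a → T (not a ∨ b) → T b
      modus-ponens {true} _ t = t

  firstChildKind-range : ∀ κ i → κ < 8 → i < 4 → firstChildKind (parentKind κ i) ≤ κ × κ < firstChildKind (parentKind κ i) + 4
  firstChildKind-range κ i κ<8 i<4 = ≤ᵇ⇒≤ _ κ (∧-projˡ both) , <ᵇ⇒< κ _ (∧-projʳ {firstChildKind (parentKind κ i) ≤ᵇ κ} both)
    where
      both = kindTable-sound (λ κ i → (firstChildKind (parentKind κ i) ≤ᵇ κ) ∧ (κ <ᵇ firstChildKind (parentKind κ i) + 4)) tt κ i κ<8 i<4

  firstChildKind-isParentKind : ∀ κ → κ < 8 → T (isParentKind (firstChildKind κ) κ)
  firstChildKind-isParentKind κ κ<8 = kindTable-sound (λ κ _ → isParentKind (firstChildKind κ) κ) tt κ 0 κ<8 (s≤s z≤n)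

  firstChildKind<8 : ∀ κ → firstChildKind κ < 8
  firstChildKind<8 κ with (κ ≡ᵇ 0) ∨ (κ ≡ᵇ 1) ∨ (κ ≡ᵇ 6) ∨ (κ ≡ᵇ 7)
  ... | true  = s≤s z≤n
  ... | false = s≤s (s≤s (s≤s (s≤s (s≤s z≤n))))

  isParentOf : ℕ → ℕ → Bool
  isParentOf x y = (suc (level x) ≡ᵇ level y) ∧ (cell x ≡ᵇ cell y / 8) ∧ isParentKind (kind y) (kind x)

  isParentOf-irrefl : ∀ x → isParentOf x x ≡ false
  isParentOf-irrefl x rewrite ≢⇒≡ᵇ-false (1+n≢n {level x}) = refl

  graph : Graph order
  graph = record
    { adj    = λ u v → isParentOf (toℕ u) (toℕ v) ∨ isParentOf (toℕ v) (toℕ u)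
    ; sym    = λ u v → ∨-comm (isParentOf (toℕ u) (toℕ v)) (isParentOf (toℕ v) (toℕ u))
    ; irrefl = λ v → cong (λ b → b ∨ b) (isParentOf-irrefl (toℕ v))
    }

  isParentOf-intro : ∀ x y i → suc (level x) ≡ level y → cell x ≡ cell y / 8 → i < 4 → kind x ≡ parentKind (kind y) i →
    T (isParentOf x y)
  isParentOf-intro x y i level≡ cell≡ i<4 kind≡ =
    ∧-intro (≡⇒≡ᵇ (suc (level x)) (level y) level≡) (∧-intro (≡⇒≡ᵇ (cell x) (cell y / 8) cell≡)
      (anyBelow-intro 4 (λ i k → parentKind (kind y) i ≡ᵇ k) (kind x) i i<4 (≡⇒≡ᵇ (parentKind (kind y) i) (kind x) (sym kind≡))))

  isParentOf-elim : ∀ x y → T (isParentOf x y) →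
    suc (level x) ≡ level y × cell x ≡ cell y / 8 × ∃[ i ] (i < 4 × parentKind (kind y) i ≡ kind x)
  isParentOf-elim x y x→y = ≡ᵇ⇒≡ _ _ (∧-projˡ x→y) , ≡ᵇ⇒≡ _ _ (∧-projˡ x→y′) , i , i<4 , ≡ᵇ⇒≡ (parentKind (kind y) i) (kind x) i≡
    where
      x→y′ = ∧-projʳ {suc (level x) ≡ᵇ level y} x→y
      which = anyBelow-elim 4 (λ i k → parentKind (kind y) i ≡ᵇ k) (kind x) (∧-projʳ {cell x ≡ᵇ cell y / 8} x→y′)
      i = proj₁ which
      i<4 = proj₁ (proj₂ which)
      i≡ = proj₂ (proj₂ which)

  inParentGroup⇒isParentOf : ∀ x y l i → level y ≡ suc l → level y ≤ H → i < 4 →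
    T (inGroup l (parentGroup y i) x) → T (isParentOf x y)
  inParentGroup⇒isParentOf x y l i level≡ ≤H i<4 x∈ =
    isParentOf-intro x y i (trans (cong suc level-x) (sym level≡)) cell-x i<4 kind-x
    where
      parent = inGroup⇒level-cell-kind l (cell y / 8) (parentKind (kind y) i) x (≤-trans (n≤1+n l) (subst (_≤ H) level≡ ≤H))
                 (parentCell< y l level≡ ≤H) (parentKind<8 (kind y) i (kind<8 y) i<4) x∈
      level-x = proj₁ parent
      cell-x  = proj₁ (proj₂ parent)
      kind-x  = proj₂ (proj₂ parent)

  isParentOf⇒inParentGroup : ∀ x y → T (isParentOf x y) → ∃[ i ] (i < 4 × T (inGroup (level y ∸ 1) (parentGroup y i) x))
  isParentOf⇒inParentGroup x y x→y = i , i<4 , subst₂ (λ l g → T (inGroup l g x)) level≡ group≡ (inGroup-own x)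
    where
      parent = isParentOf-elim x y x→y
      i = proj₁ (proj₂ (proj₂ parent))
      i<4 = proj₁ (proj₂ (proj₂ (proj₂ parent)))
      level≡ : level x ≡ level y ∸ 1
      level≡ = cong (_∸ 1) (proj₁ parent)
      group≡ : group x ≡ parentGroup y i
      group≡ = trans (group≡8cell+kind x) (cong₂ (λ c k → 8 * c + k) (proj₁ (proj₂ parent)) (sym (proj₂ (proj₂ (proj₂ (proj₂ parent))))))

  -- The t-th child cell of cell c on level l + 1, restricted to the four kinds from κ on.
  childStart : ℕ → ℕ → ℕ → ℕ → ℕ
  childStart l c κ t = groupStart (suc l) (8 * (8 * c + t) + κ)

  isParentOf⇒childRange : ∀ y x → x < order → T (isParentOf y x) →
    level y < H × ∃[ t ] (t < 8 × T (inRange (childStart (level y) (cell y) (firstChildKind (kind y)) t) (4 * groupSize (suc (level y))) x))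
  isParentOf⇒childRange y x x<order y→x = level-y<H , t , m%n<n (cell x) 8 ,
    subst₂ (λ l s → T (inRange (l * width + (8 * (8 * cell y + t) + κ) * s) (4 * s) x)) (sym level≡) (cong groupSize (sym level≡))
      (inGroups-range x (8 * (8 * cell y + t) + κ) 4 κ-lower κ-upper)
    where
      child = isParentOf-elim y x y→x
      level≡ : suc (level y) ≡ level x
      level≡ = proj₁ child
      i = proj₁ (proj₂ (proj₂ child))
      kind≡ : parentKind (kind x) i ≡ kind y
      kind≡ = proj₂ (proj₂ (proj₂ (proj₂ child)))
      range = firstChildKind-range (kind x) i (kind<8 x) (proj₁ (proj₂ (proj₂ (proj₂ child))))
      level-y<H : level y < H
      level-y<H = subst (_≤ H) (sym level≡) (level≤H x x<order)
      t = cell x % 8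
      κ = firstChildKind (kind y)
      group≡ : group x ≡ 8 * (8 * cell y + t) + kind x
      group≡ = trans (group≡8cell+kind x)
        (cong (λ c → 8 * c + kind x) (trans (a≡8[a/8]+a%8 (cell x)) (cong (λ c → 8 * c + t) (sym (proj₁ (proj₂ child))))))
      κ-lower : 8 * (8 * cell y + t) + κ ≤ group x
      κ-lower = ≤-trans (+-monoʳ-≤ _ (subst (λ k → firstChildKind k ≤ kind x) kind≡ (proj₁ range))) (≤-reflexive (sym group≡))
      κ-upper : group x < 8 * (8 * cell y + t) + κ + 4
      κ-upper = ≤-trans (≤-reflexive (cong suc group≡))
        (≤-trans (≤-reflexive (sym (+-suc _ (kind x))))
          (≤-trans (+-monoʳ-≤ _ (subst (λ k → kind x < firstChildKind k + 4) kind≡ (proj₂ range)))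
            (≤-reflexive (sym (+-assoc _ κ 4)))))

  childCount-≤ : ∀ (y : Fin order) → count {order} (isParentOf (toℕ y) ∘ toℕ) ≤ 4 * groupSize (level (toℕ y))
  childCount-≤ y with level (toℕ y) <? H
  ... | no ¬l<H = ≤-trans (countIn-mono _ (λ _ → false) (allFin order)
                     (λ u y→u → ¬l<H (proj₁ (isParentOf⇒childRange (toℕ y) (toℕ u) (toℕ<n u) y→u))))
                    (≤-trans (≤-reflexive (trans (count-toℕ order (λ _ → false)) (countBelow-false order _ (λ _ _ → refl)))) z≤n)
  ... | yes l<H = begin
      count {order} (isParentOf (toℕ y) ∘ toℕ)
        ≤⟨ count-covered-by-intervals order 8 (isParentOf (toℕ y) ∘ toℕ) (childStart l (cell (toℕ y)) (firstChildKind (kind (toℕ y)))) (4 * groupSize (suc l)) children ⟩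
      8 * (4 * groupSize (suc l))        ≡⟨ solve 1 (λ s → con 8 :* (con 4 :* s) := con 4 :* (con 8 :* s)) refl (groupSize (suc l)) ⟩
      4 * (8 * groupSize (suc l))        ≡⟨ cong (4 *_) (sym (groupSize-suc l l<H)) ⟩
      4 * groupSize l                    ∎
    where
      open ≤-Reasoning
      open +-*-Solver
      l = level (toℕ y)
      children : ∀ u → T (isParentOf (toℕ y) (toℕ u)) →
        ∃[ t ] (t < 8 × T (inRange (childStart l (cell (toℕ y)) (firstChildKind (kind (toℕ y))) t) (4 * groupSize (suc l)) (toℕ u)))
      children u y→u = proj₂ (isParentOf⇒childRange (toℕ y) (toℕ u) (toℕ<n u) y→u)

  parentCount-≤ : ∀ (y : Fin order) → count {order} (λ u → isParentOf (toℕ u) (toℕ y)) ≤ 4 * groupSize (level (toℕ y) ∸ 1)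
  parentCount-≤ y = count-covered-by-intervals order 4 (λ u → isParentOf (toℕ u) (toℕ y))
                      (λ i → groupStart (level (toℕ y) ∸ 1) (parentGroup (toℕ y) i)) (groupSize (level (toℕ y) ∸ 1))
                      (λ u u→y → isParentOf⇒inParentGroup (toℕ u) (toℕ y) u→y)

  deg-≤ : ∀ (y : Fin order) → deg graph y ≤ 4 * groupSize (level (toℕ y)) + 4 * groupSize (level (toℕ y) ∸ 1)
  deg-≤ y = ≤-trans (countIn-∨-≤ (isParentOf (toℕ y) ∘ toℕ) (λ u → isParentOf (toℕ u) (toℕ y)) (allFin order))
                    (+-mono-≤ (childCount-≤ y) (parentCount-≤ y))

  ParentsConflict : Process → Coloring order → Fin order → ℕ → ℕ → Set
  ParentsConflict P col y l missing = ∀ i → i < 4 → ¬ i ≡ missing → ∀ (x : Fin order) →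
    T (inGroup l (parentGroup (toℕ y) i) (toℕ x)) → conflictColors P (col y) (col x) ≡ true

  conflictDeg-≥ : ∀ P col (y : Fin order) l missing → level (toℕ y) ≡ suc l → missing < 4 →
    ParentsConflict P col y l missing → 3 * groupSize l ≤ conflictDeg P graph col y
  conflictDeg-≥ P col y l missing level≡ missing<4 conflicts = begin
      3 * groupSize l
        ≤⟨ sumBelow-skip 4 (λ i → count {order} (present i ∘ toℕ)) (groupSize l) missing missing<4
                         (λ i i<4 i≢ → ≤-reflexive (sym (count-present i i<4 i≢))) ⟩
      sumBelow 4 (λ i → count {order} (present i ∘ toℕ))
        ≡⟨ count-anyBelow-disjoint order 4 present disjoint ⟩
      count {order} (anyBelow 4 present ∘ toℕ)
        ≤⟨ countIn-mono (anyBelow 4 present ∘ toℕ) (λ u → adj graph y u ∧ conflictColors P (col y) (col u)) (allFin order) conflicting ⟩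
      conflictDeg P graph col y
        ∎
    where
      open ≤-Reasoning
      ty = toℕ y
      ≤H = level≤H ty (toℕ<n y)
      l<H : l < H
      l<H = subst (_≤ H) level≡ ≤H
      present : ℕ → ℕ → Bool
      present i x = not (i ≡ᵇ missing) ∧ inGroup l (parentGroup ty i) x
      count-present : ∀ i → i < 4 → ¬ i ≡ missing → count {order} (present i ∘ toℕ) ≡ groupSize l
      count-present i i<4 i≢ rewrite ≢⇒≡ᵇ-false i≢ =
        count-inRange order (groupStart l (parentGroup ty i)) (groupSize l) (group-fits l (parentGroup ty i) (<⇒≤ l<H)
          (8a+k<8^[1+l] _ _ l (parentCell< ty l level≡ ≤H) (parentKind<8 (kind ty) i (kind<8 ty) i<4)))
      disjoint : ∀ i i' x → i < i' → i' < 4 → T (present i x) → T (present i' x) → ⊥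
      disjoint i i' x i<i' i'<4 x∈ x∈' = <⇒≢ i<i' (parentKind-injective (kind ty) i i' (kind<8 ty) (<-trans i<i' i'<4) i'<4
        (trans (sym (proj₂ (proj₂ (at i (<-trans i<i' i'<4) x∈)))) (proj₂ (proj₂ (at i' i'<4 x∈')))))
        where
          at : ∀ i → i < 4 → T (present i x) → level x ≡ l × cell x ≡ cell ty / 8 × kind x ≡ parentKind (kind ty) i
          at i i<4 x∈ = inGroup⇒level-cell-kind l (cell ty / 8) (parentKind (kind ty) i) x (<⇒≤ l<H)
                          (parentCell< ty l level≡ ≤H) (parentKind<8 (kind ty) i (kind<8 ty) i<4) (∧-projʳ {not (i ≡ᵇ missing)} x∈)
      conflicting : ∀ u → T (anyBelow 4 present (toℕ u)) → T (adj graph y u ∧ conflictColors P (col y) (col u))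
      conflicting u u∈ with anyBelow-elim 4 present (toℕ u) u∈
      ... | i , i<4 , u∈i with i ≡ᵇ missing in i≟
      ...   | false = ∧-intro (∨-injʳ {isParentOf ty (toℕ u)} (inParentGroup⇒isParentOf (toℕ u) ty l i level≡ ≤H i<4 u∈i))
                              (≡true⇒T (conflicts i i<4 (λ i≡ → subst T i≟ (≡⇒≡ᵇ i missing i≡)) u u∈i))

  switchable-if-parents-conflict : ∀ P col (y : Fin order) l missing → level (toℕ y) ≡ suc l → missing < 4 →
    ParentsConflict P col y l missing → Switchable 1 3 P graph col y
  switchable-if-parents-conflict P col y l missing level≡ missing<4 conflicts = begin
      4 * deg graph y                                             ≤⟨ *-monoʳ-≤ 4 (deg-≤ y) ⟩
      4 * (4 * groupSize (level ty) + 4 * groupSize (level ty ∸ 1)) ≡⟨ cong (λ k → 4 * (4 * groupSize k + 4 * groupSize (k ∸ 1))) level≡ ⟩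
      4 * (4 * groupSize (suc l) + 4 * groupSize l)               ≡⟨ cong (λ s → 4 * (4 * groupSize (suc l) + 4 * s)) (groupSize-suc l l<H) ⟩
      4 * (4 * s + 4 * (8 * s))                                   ≡⟨ solve 1 (λ s → con 4 :* (con 4 :* s :+ con 4 :* (con 8 :* s)) := con 6 :* (con 3 :* (con 8 :* s))) refl s ⟩
      6 * (3 * (8 * s))                                           ≡⟨ cong (λ s → 6 * (3 * s)) (sym (groupSize-suc l l<H)) ⟩
      6 * (3 * groupSize l)                                       ≤⟨ *-monoʳ-≤ 6 (conflictDeg-≥ P col y l missing level≡ missing<4 conflicts) ⟩
      6 * conflictDeg P graph col y                               ∎
    where
      open ≤-Reasoning
      open +-*-Solver
      ty = toℕ y
      s = groupSize (suc l)
      l<H : l < H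
      l<H = subst (_≤ H) level≡ (level≤H ty (toℕ<n y))

  deg-≥-group : ∀ (y : Fin order) l g → l ≤ H → g < 8 ^ suc l → (∀ u → T (inGroup l g (toℕ u)) → T (adj graph y u)) →
    groupSize l ≤ deg graph y
  deg-≥-group y l g l≤H g< neighbours = begin
      groupSize l                ≡⟨ sym (count-inRange order (groupStart l g) (groupSize l) (group-fits l g l≤H g<)) ⟩
      count {order} (inGroup l g ∘ toℕ)  ≤⟨ countIn-mono (inGroup l g ∘ toℕ) (adj graph y) (allFin order) neighbours ⟩
      deg graph y                ∎
    where open ≤-Reasoning

  deg-pos : 1 ≤ H → ∀ (y : Fin order) → 1 ≤ deg graph y
  deg-pos H≥1 y = by-level (level ty) refl
    where
      ty = toℕ y
      ≤H = level≤H ty (toℕ<n y)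
      by-level : ∀ l → level ty ≡ l → 1 ≤ deg graph y
      by-level (suc l) level≡ =
        ≤-trans (groupSize-pos l) (deg-≥-group y l (parentGroup ty 0) (<⇒≤ (subst (_≤ H) level≡ ≤H))
          (8a+k<8^[1+l] _ _ l (parentCell< ty l level≡ ≤H) (parentKind<8 (kind ty) 0 (kind<8 ty) (s≤s z≤n)))
          (λ u u∈ → ∨-injʳ {isParentOf ty (toℕ u)} (inParentGroup⇒isParentOf (toℕ u) ty l 0 level≡ ≤H (s≤s z≤n) u∈)))
      by-level zero level≡ = ≤-trans (groupSize-pos 1) (deg-≥-group y 1 κ H≥1 κ<64 child)
        where
          κ = firstChildKind (kind ty)
          κ<64 : κ < 8 ^ 2
          κ<64 = ≤-trans (firstChildKind<8 (kind ty)) (m≤m*n 8 8)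
          cell≡0 : cell ty ≡ 0
          cell≡0 = m<n⇒m/n≡0 (subst (λ l → group ty < 8 ^ suc l) level≡ (group< ty ≤H))
          child : ∀ u → T (inGroup 1 κ (toℕ u)) → T (adj graph y u)
          child u u∈ = ∨-injˡ {isParentOf ty (toℕ u)} (∧-intro (≡⇒≡ᵇ _ _ (trans (cong suc level≡) (sym (proj₁ at))))
            (∧-intro (≡⇒≡ᵇ _ _ (trans cell≡0 (sym (cong (_/ 8) (proj₁ (proj₂ at))))))
              (subst (λ k → T (isParentKind k (kind ty))) (sym (proj₂ (proj₂ at))) (firstChildKind-isParentKind (kind ty) (kind<8 ty)))))
            where at = inGroup⇒level-cell-kind 1 0 κ (toℕ u) H≥1 (s≤s z≤n) (firstChildKind<8 (kind ty)) u∈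

  noIsolated : 1 ≤ H → NoIsolated graph
  noIsolated H≥1 y deg≡0 = <⇒≢ (deg-pos H≥1 y) (sym deg≡0)

module Schedule (H : ℕ) (P : Process) where
  open Construction H
  open Runs 1 3 P graph

  isMinority : Process → Bool
  isMinority majority = false
  isMinority minority = true

  parity : ℕ → Bool
  parity zero    = false
  parity (suc l) = not (parity l)

  -- In the minority process colours are inverted on every other level, which turns the
  -- "different colours" conflicts of the majority process into "same colour" ones.
  twist : ℕ → Bool
  twist l = isMinority P ∧ parity l

  baseColour : ℕ → Bool
  baseColour κ = 4 ≤ᵇ κ

  standard : ℕ → Bool
  standard x = baseColour (kind x) xor twist (level x)

  parent-child-conflict : ∀ b l → conflictColors P (b xor twist (suc l)) (not b xor twist l) ≡ true
  parent-child-conflict b l = alternating P b (parity l)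
    where
      alternating : ∀ Q b p → conflictColors Q (b xor (isMinority Q ∧ not p)) (not b xor (isMinority Q ∧ p)) ≡ true
      alternating majority false _     = refl
      alternating majority true  _     = refl
      alternating minority false false = refl
      alternating minority false true  = refl
      alternating minority true  false = refl
      alternating minority true  true  = refl

  data Dir : Set where
    up down : Dir

  data Round : Set where
    first second : Round

  isDown : Dir → Bool
  isDown up   = false
  isDown down = true

  preKinds midKinds postKinds : Dir → List ℕ
  preKinds  up   = 0 ∷ 4 ∷ []
  preKinds  down = 6 ∷ 2 ∷ []
  midKinds  up   = 2 ∷ 3 ∷ 6 ∷ 7 ∷ []
  midKinds  down = 4 ∷ 5 ∷ 0 ∷ 1 ∷ []
  postKinds up   = 1 ∷ 5 ∷ []
  postKinds down = 7 ∷ 3 ∷ []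

  roundDir : Round → Dir
  roundDir first  = up
  roundDir second = down

  -- The direction of the parent cell's run and the round in which the cell runs.
  ParentState : Set
  ParentState = Dir × Round

  childDir : ParentState → Dir
  childDir (_ , r) = roundDir r

  -- Membership counted modulo 2; on the duplicate-free kind lists above it is membership.
  memᵇ : List ℕ → ℕ → Bool
  memᵇ []       k = false
  memᵇ (κ ∷ κs) k = (k ≡ᵇ κ) xor memᵇ κs k

  validKinds : List ℕ → Bool
  validKinds []       = true
  validKinds (κ ∷ κs) = (κ <ᵇ 8) ∧ not (memᵇ κs κ) ∧ validKinds κs

  flippedBefore : Dir → Round → ℕ → Bool
  flippedBefore d first  κ = memᵇ (preKinds d) κ
  flippedBefore d second κ = memᵇ (preKinds d) κ xor memᵇ (midKinds d) κ

  parentColour : ParentState → ℕ → Bool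
  parentColour (d , r) κ = (isDown d xor baseColour κ) xor flippedBefore d r κ

  -- The one parent group (index into parentKind) that does not conflict with the children.
  missingIndex : ParentState → ℕ
  missingIndex (up   , first)  = 1
  missingIndex (up   , second) = 0
  missingIndex (down , first)  = 3
  missingIndex (down , second) = 2

  missingIndex<4 : ∀ ps → missingIndex ps < 4
  missingIndex<4 (up   , first)  = s≤s (s≤s z≤n)
  missingIndex<4 (up   , second) = s≤s z≤n
  missingIndex<4 (down , first)  = s≤s (s≤s (s≤s (s≤s z≤n)))
  missingIndex<4 (down , second) = s≤s (s≤s (s≤s z≤n))

  parentColour-opposes : ∀ ps κ i → κ < 8 → i < 4 → ¬ i ≡ missingIndex ps →
    parentColour ps (parentKind κ i) ≡ not (isDown (childDir ps) xor baseColour κ)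
  parentColour-opposes ps κ i κ<8 i<4 i≢ = xnor⇒≡ (unless-missing (kindTable-sound (check ps) (table ps) κ i κ<8 i<4))
    where
      check : ParentState → ℕ → ℕ → Bool
      check ps κ i = (i ≡ᵇ missingIndex ps) ∨ not (parentColour ps (parentKind κ i) xor not (isDown (childDir ps) xor baseColour κ))
      table : ∀ ps → T (kindTable (check ps))
      table (up   , first)  = tt
      table (up   , second) = tt
      table (down , first)  = tt
      table (down , second) = tt
      unless-missing : ∀ {b} → T ((i ≡ᵇ missingIndex ps) ∨ b) → T b
      unless-missing t rewrite ≢⇒≡ᵇ-false i≢ = t

  scheduleTable : Dir → ℕ → Bool
  scheduleTable d κ = (not (memᵇ (midKinds d) κ) ∨ not (memᵇ (preKinds d) κ))
                    ∧ (not (memᵇ (postKinds d) κ) ∨ not (flippedBefore d second κ))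
                    ∧ (flippedBefore d second κ xor memᵇ (postKinds d) κ)

  scheduleTable-sound : ∀ d κ → κ < 8 → T (scheduleTable d κ)
  scheduleTable-sound d κ κ<8 = allBelow-sound 8 (scheduleTable d) (table d) κ κ<8
    where
      table : ∀ d → T (allBelow 8 (scheduleTable d))
      table up   = tt
      table down = tt

  not-both : ∀ {a b} → T (not a ∨ not b) → T a → b ≡ false
  not-both {true} {false} _ _ = refl

  mid-not-pre : ∀ d κ → κ < 8 → T (memᵇ (midKinds d) κ) → memᵇ (preKinds d) κ ≡ false
  mid-not-pre d κ κ<8 = not-both {memᵇ (midKinds d) κ} (∧-projˡ (scheduleTable-sound d κ κ<8))

  post-not-before : ∀ d κ → κ < 8 → T (memᵇ (postKinds d) κ) → flippedBefore d second κ ≡ false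
  post-not-before d κ κ<8 = not-both {memᵇ (postKinds d) κ} (∧-projˡ (∧-projʳ {not (memᵇ (midKinds d) κ) ∨ not (memᵇ (preKinds d) κ)} (scheduleTable-sound d κ κ<8)))

  all-kinds-flipped : ∀ d κ → κ < 8 → flippedBefore d second κ xor memᵇ (postKinds d) κ ≡ true
  all-kinds-flipped d κ κ<8 = T⇒≡true (∧-projʳ {not (memᵇ (postKinds d) κ) ∨ not (flippedBefore d second κ)}
    (∧-projʳ {not (memᵇ (midKinds d) κ) ∨ not (memᵇ (preKinds d) κ)} (scheduleTable-sound d κ κ<8)))

  inGroups : ℕ → ℕ → List ℕ → ℕ → Bool
  inGroups j c κs z = (level z ≡ᵇ j) ∧ (cell z ≡ᵇ c) ∧ memᵇ κs (kind z)

  inGroups-[] : ∀ j c z → inGroups j c [] z ≡ false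
  inGroups-[] j c z = trans (cong ((level z ≡ᵇ j) ∧_) (∧-zeroʳ (cell z ≡ᵇ c))) (∧-zeroʳ (level z ≡ᵇ j))

  inGroups-∷ : ∀ j c κ κs z → inGroups j c (κ ∷ κs) z ≡ inGroups j c (κ ∷ []) z xor inGroups j c κs z
  inGroups-∷ j c κ κs z with level z ≡ᵇ j | cell z ≡ᵇ c
  ... | true  | true  = cong (_xor memᵇ κs (kind z)) (sym (xor-identityʳ (kind z ≡ᵇ κ)))
  ... | true  | false = refl
  ... | false | _     = refl

  inGroups-at : ∀ j c κs z → level z ≡ j → cell z ≡ c → inGroups j c κs z ≡ memᵇ κs (kind z)
  inGroups-at j c κs z refl refl rewrite ≡ᵇ-refl (level z) | ≡ᵇ-refl (cell z) = refl

  inGroups-off : ∀ j c κs z → ¬ level z ≡ j → inGroups j c κs z ≡ false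
  inGroups-off j c κs z level≢ rewrite ≢⇒≡ᵇ-false level≢ = refl

  inGroup≡inGroups : ∀ j c κ z → j ≤ H → c < 8 ^ j → κ < 8 → inGroup j (8 * c + κ) z ≡ inGroups j c (κ ∷ []) z
  inGroup≡inGroups j c κ z j≤H c< κ<8 = T-extensional to from
    where
      to : T (inGroup j (8 * c + κ) z) → T (inGroups j c (κ ∷ []) z)
      to z∈ = let (level≡ , cell≡ , kind≡) = inGroup⇒level-cell-kind j c κ z j≤H c< κ<8 z∈
              in subst T (sym (inGroups-at j c (κ ∷ []) z level≡ cell≡))
                   (subst (λ k → T ((k ≡ᵇ κ) xor false)) (sym kind≡) (subst T (sym (xor-identityʳ (κ ≡ᵇ κ))) (≡⇒≡ᵇ κ κ refl)))
      from : T (inGroups j c (κ ∷ []) z) → T (inGroup j (8 * c + κ) z)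
      from z∈ = subst₂ (λ l g → T (inGroup l g z)) level≡ (trans (group≡8cell+kind z) (cong₂ (λ c k → 8 * c + k) cell≡ kind≡)) (inGroup-own z)
        where
          level≡ = ≡ᵇ⇒≡ (level z) j (∧-projˡ z∈)
          rest = ∧-projʳ {level z ≡ᵇ j} z∈
          cell≡ = ≡ᵇ⇒≡ (cell z) c (∧-projˡ rest)
          kind≡ = ≡ᵇ⇒≡ (kind z) κ (subst T (xor-identityʳ (kind z ≡ᵇ κ)) (∧-projʳ {cell z ≡ᵇ c} rest))

  -- Decided rather than proved, so that runs can be written down without proof terms;
  -- the bound holds wherever a run is used.
  groupRun : ℕ → ℕ → ℕ → List (Fin order)
  groupRun j c κ with groupStart j (8 * c + κ) + groupSize j ≤? order
  ... | yes fits = intervalRun (groupStart j (8 * c + κ)) (groupSize j) fits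
  ... | no  _    = []

  groupRun-unfold : ∀ j c κ → groupStart j (8 * c + κ) + groupSize j ≤ order →
    Σ (groupStart j (8 * c + κ) + groupSize j ≤ order) λ fits → groupRun j c κ ≡ intervalRun (groupStart j (8 * c + κ)) (groupSize j) fits
  groupRun-unfold j c κ fits with groupStart j (8 * c + κ) + groupSize j ≤? order
  ... | yes fits′ = fits′ , refl
  ... | no  ¬fits = ⊥-elim (¬fits fits)

  groupsRun : ℕ → ℕ → List ℕ → List (Fin order)
  groupsRun j c []       = []
  groupsRun j c (κ ∷ κs) = groupRun j c κ ++ groupsRun j c κs

  -- Colouring around the cell c of level l + 1 while it runs: its parent cell shows the
  -- parent state, the kinds `own` of the cell have been flipped, and below the cell
  -- everything is standard except level l + 2, which is flipped when `kids` holds.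
  record CellState (l c : ℕ) (ps : ParentState) (own : ℕ → Bool) (kids : Bool) (col : Coloring order) : Set where
    field
      parentCell : ∀ x → level (toℕ x) ≡ l → cell (toℕ x) ≡ c / 8 →
        col x ≡ parentColour ps (kind (toℕ x)) xor twist l
      ownCell : ∀ x → level (toℕ x) ≡ suc l → cell (toℕ x) ≡ c →
        col x ≡ ((isDown (childDir ps) xor baseColour (kind (toℕ x))) xor twist (suc l)) xor own (kind (toℕ x))
      belowCell : ∀ x → suc (suc l) ≤ level (toℕ x) → ancestor (toℕ x) (suc l) ≡ c →
        col x ≡ (kids ∧ (level (toℕ x) ≡ᵇ suc (suc l))) xor standard (toℕ x)

  CellState-flipGroups : ∀ {l c ps own kids col col'} κs → CellState l c ps own kids col →
    (∀ x → col' x ≡ col x xor inGroups (suc l) c κs (toℕ x)) →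
    CellState l c ps (λ κ → own κ xor memᵇ κs κ) kids col'
  CellState-flipGroups {l} {c} {ps} {own} {kids} {col} {col'} κs state flip = record
    { parentCell = λ x level≡ cell≡ → trans (unflipped x (λ e → 1+n≢n (trans (sym e) level≡))) (parentCell x level≡ cell≡)
    ; ownCell    = λ x level≡ cell≡ → trans (flip x) (trans (cong₂ _xor_ (ownCell x level≡ cell≡) (inGroups-at (suc l) c κs (toℕ x) level≡ cell≡))
                                        (xor-assoc ((isDown (childDir ps) xor baseColour (kind (toℕ x))) xor twist (suc l)) (own (kind (toℕ x))) (memᵇ κs (kind (toℕ x)))))
    ; belowCell  = λ x below anc≡ → trans (unflipped x (λ e → <⇒≢ below (sym e))) (belowCell x below anc≡)
    }
    where
      open CellState state
      unflipped : ∀ x → ¬ level (toℕ x) ≡ suc l → col' x ≡ col x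
      unflipped x level≢ = trans (flip x) (trans (cong (col x xor_) (inGroups-off (suc l) c κs (toℕ x) level≢)) (xor-identityʳ (col x)))

  groupRun-flips : ∀ {l c ps own kids col} κ → suc l ≤ H → c < 8 ^ suc l → κ < 8 → own κ ≡ false →
    CellState l c ps own kids col → Flips col (groupRun (suc l) c κ) (inGroups (suc l) c (κ ∷ []))
  groupRun-flips {l} {c} {ps} {own} {kids} {col} κ ≤H c< κ<8 unflipped state =
    Flips-cong (inGroup (suc l) (8 * c + κ)) (inGroups (suc l) c (κ ∷ [])) (λ x → inGroup≡inGroups (suc l) c κ (toℕ x) ≤H c< κ<8)
      (subst (λ run → Flips col run (inGroup (suc l) (8 * c + κ))) (sym (proj₂ unfold))
        (intervalRun-flips (groupStart (suc l) (8 * c + κ)) (groupSize (suc l)) (proj₁ unfold) col stable))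
    where
      open CellState state
      unfold = groupRun-unfold (suc l) c κ (group-fits (suc l) (8 * c + κ) ≤H (8a+k<8^[1+l] c κ (suc l) c< κ<8))
      b = isDown (childDir ps) xor baseColour κ
      stable : StablySwitchable (groupStart (suc l) (8 * c + κ)) (groupSize (suc l)) col
      stable col' y y∈ agree col'y≡ =
        switchable-if-parents-conflict P col' y l (missingIndex ps) level-y (missingIndex<4 ps) conflicts
        where
          at = inGroup⇒level-cell-kind (suc l) c κ (toℕ y) ≤H c< κ<8 y∈
          level-y = proj₁ at
          cell-y = proj₁ (proj₂ at)
          kind-y = proj₂ (proj₂ at)
          colour-y : col' y ≡ b xor twist (suc l)
          colour-y = trans col'y≡ (trans (ownCell y level-y cell-y)
            (trans (cong (λ k → ((isDown (childDir ps) xor baseColour k) xor twist (suc l)) xor own k) kind-y)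
              (trans (cong ((b xor twist (suc l)) xor_) unflipped) (xor-identityʳ _))))
          conflicts : ParentsConflict P col' y l (missingIndex ps)
          conflicts i i<4 i≢ x x∈ = subst₂ (λ p q → conflictColors P p q ≡ true) (sym colour-y) (sym colour-x) (parent-child-conflict b l)
            where
              parent = inGroup⇒level-cell-kind l (cell (toℕ y) / 8) (parentKind (kind (toℕ y)) i) (toℕ x) (<⇒≤ ≤H)
                (parentCell< (toℕ y) l level-y (level≤H (toℕ y) (toℕ<n y))) (parentKind<8 (kind (toℕ y)) i (kind<8 (toℕ y)) i<4) x∈
              level-x = proj₁ parent
              outside : inGroup (suc l) (8 * c + κ) (toℕ x) ≡ false
              outside = ¬T⇒≡false (λ x∈′ → 1+n≢n (trans (sym (proj₁ (inGroup⇒level-cell-kind (suc l) c κ (toℕ x) ≤H c< κ<8 x∈′))) level-x))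
              colour-x : col' x ≡ not b xor twist l
              colour-x = trans (agree x outside) (trans (parentCell x level-x (trans (proj₁ (proj₂ parent)) (cong (_/ 8) cell-y)))
                (cong (_xor twist l) (trans (cong (parentColour ps) (trans (proj₂ (proj₂ parent)) (cong (λ k → parentKind k i) kind-y)))
                  (parentColour-opposes ps κ i κ<8 i<4 i≢))))

  inChildren : ℕ → ℕ → ℕ → Bool
  inChildren j c z = (level z ≡ᵇ suc j) ∧ (cell z / 8 ≡ᵇ c)

  inChildren-off : ∀ j c z → ¬ level z ≡ suc j → inChildren j c z ≡ false
  inChildren-off j c z level≢ rewrite ≢⇒≡ᵇ-false level≢ = refl

  inChildren-below : ∀ j c z → suc j ≤ level z → ancestor z j ≡ c → inChildren j c z ≡ (level z ≡ᵇ suc j)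
  inChildren-below j c z j<level ancestor≡ with level z ≡ᵇ suc j in e
  ... | false = refl
  ... | true  = T⇒≡true (≡⇒≡ᵇ (cell z / 8) c (begin
      cell z / 8                  ≡⟨ cong (_/ 8) (sym (ancestor-self z)) ⟩
      ancestor z (level z) / 8    ≡⟨ cong (λ l → ancestor z l / 8) (≡ᵇ⇒≡ (level z) (suc j) (≡true⇒T e)) ⟩
      ancestor z (suc j) / 8      ≡⟨ sym (ancestor-step z j j<level) ⟩
      ancestor z j                ≡⟨ ancestor≡ ⟩
      c                           ∎))
    where open ≡-Reasoning

  inFirstChildren : ℕ → ℕ → ℕ → ℕ → Bool
  inFirstChildren j c k z = (level z ≡ᵇ suc j) ∧ (cell z / 8 ≡ᵇ c) ∧ (cell z % 8 <ᵇ k)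

  inCell : ℕ → ℕ → ℕ → Bool
  inCell j c z = (level z ≡ᵇ j) ∧ (cell z ≡ᵇ c)

  inFirstChildren-zero : ∀ j c z → inFirstChildren j c 0 z ≡ false
  inFirstChildren-zero j c z = trans (cong ((level z ≡ᵇ suc j) ∧_) (∧-zeroʳ (cell z / 8 ≡ᵇ c))) (∧-zeroʳ (level z ≡ᵇ suc j))

  inFirstChildren-suc : ∀ j c k z → k < 8 → inFirstChildren j c (suc k) z ≡ inFirstChildren j c k z xor inCell (suc j) (8 * c + k) z
  inFirstChildren-suc j c k z k<8 = begin
      L ∧ C ∧ (cell z % 8 <ᵇ suc k)                        ≡⟨ cong (λ b → L ∧ C ∧ b) (<ᵇ-suc (cell z % 8) k) ⟩
      L ∧ C ∧ ((cell z % 8 <ᵇ k) xor (cell z % 8 ≡ᵇ k))    ≡⟨ distrib L C (cell z % 8 <ᵇ k) (cell z % 8 ≡ᵇ k) ⟩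
      (L ∧ C ∧ (cell z % 8 <ᵇ k)) xor (L ∧ C ∧ (cell z % 8 ≡ᵇ k))
        ≡⟨ cong (λ b → (L ∧ C ∧ (cell z % 8 <ᵇ k)) xor (L ∧ b)) (sym (≡ᵇ-8c+k (cell z) c k k<8)) ⟩
      inFirstChildren j c k z xor inCell (suc j) (8 * c + k) z ∎
    where
      open ≡-Reasoning
      open xor-∧-Solver
      L = level z ≡ᵇ suc j
      C = cell z / 8 ≡ᵇ c
      distrib : ∀ L C a b → L ∧ C ∧ (a xor b) ≡ (L ∧ C ∧ a) xor (L ∧ C ∧ b)
      distrib = solve 4 (λ L C a b → L :* (C :* (a :+ b)) := (L :* (C :* a)) :+ (L :* (C :* b))) refl

  inFirstChildren-8 : ∀ j c z → inFirstChildren j c 8 z ≡ inChildren j c z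
  inFirstChildren-8 j c z rewrite T⇒≡true (<⇒<ᵇ (m%n<n (cell z) 8)) =
    cong ((level z ≡ᵇ suc j) ∧_) (∧-identityʳ (cell z / 8 ≡ᵇ c))

  CellState-flipChildren : ∀ {l c ps own kids col col'} → CellState l c ps own kids col →
    (∀ x → col' x ≡ col x xor inChildren (suc l) c (toℕ x)) → CellState l c ps own (not kids) col'
  CellState-flipChildren {l} {c} {ps} {own} {kids} {col} {col'} state flip = record
    { parentCell = λ x level≡ cell≡ → trans (unflipped x (λ e → <⇒≢ (m<n⇒m<1+n (n<1+n l)) (trans (sym level≡) e))) (parentCell x level≡ cell≡)
    ; ownCell    = λ x level≡ cell≡ → trans (unflipped x (λ e → <⇒≢ (n<1+n (suc l)) (trans (sym level≡) e))) (ownCell x level≡ cell≡)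
    ; belowCell  = λ x below ancestor≡ → begin
        col' x                                                           ≡⟨ flip x ⟩
        col x xor inChildren (suc l) c (toℕ x)                           ≡⟨ cong₂ _xor_ (belowCell x below ancestor≡) (inChildren-below (suc l) c (toℕ x) below ancestor≡) ⟩
        ((kids ∧ L x) xor standard (toℕ x)) xor L x                      ≡⟨ toggle kids (L x) (standard (toℕ x)) ⟩
        (not kids ∧ L x) xor standard (toℕ x)                            ∎
    }
    where
      open CellState state
      open ≡-Reasoning
      open xor-∧-Solver
      L : Fin order → Bool
      L x = level (toℕ x) ≡ᵇ suc (suc l)
      unflipped : ∀ x → ¬ level (toℕ x) ≡ suc (suc l) → col' x ≡ col x
      unflipped x level≢ = trans (flip x) (trans (cong (col x xor_) (inChildren-off (suc l) c (toℕ x) level≢)) (xor-identityʳ (col x)))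
      toggle : ∀ k L s → ((k ∧ L) xor s) xor L ≡ (not k ∧ L) xor s
      toggle = solve 3 (λ k L s → ((k :* L) :+ s) :+ L := ((con true :+ k) :* L) :+ s) refl

  groupsRun-flips : ∀ {l c ps own kids col} κs → suc l ≤ H → c < 8 ^ suc l →
    T (validKinds κs) → (∀ κ → κ < 8 → T (memᵇ κs κ) → own κ ≡ false) →
    CellState l c ps own kids col → Flips col (groupsRun (suc l) c κs) (inGroups (suc l) c κs)
  groupsRun-flips {l} {c} {col = col} [] ≤H c< _ _ _ =
    tt , λ x → sym (trans (cong (col x xor_) (inGroups-[] (suc l) c (toℕ x))) (xor-identityʳ (col x)))
  groupsRun-flips {l} {c} {ps} {own} (κ ∷ κs) ≤H c< valid unflipped state =
    Flips-cong (λ z → inGroups (suc l) c (κ ∷ []) z xor inGroups (suc l) c κs z) (inGroups (suc l) c (κ ∷ κs)) (λ x → sym (inGroups-∷ (suc l) c κ κs (toℕ x)))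
      (Flips-++ (groupRun (suc l) c κ) (groupsRun (suc l) c κs) (inGroups (suc l) c (κ ∷ [])) (inGroups (suc l) c κs)
        (groupRun-flips κ ≤H c< κ<8 (unflipped κ κ<8 κ∈) state)
        (λ col' flip → groupsRun-flips κs ≤H c< (∧-projʳ {not (memᵇ κs κ)} (∧-projʳ {κ <ᵇ 8} valid))
                         unflipped-rest (CellState-flipGroups (κ ∷ []) state flip)))
    where
      κ<8 = <ᵇ⇒< κ 8 (∧-projˡ valid)
      κ∉κs : memᵇ κs κ ≡ false
      κ∉κs = T-not⇒≡false (∧-projˡ (∧-projʳ {κ <ᵇ 8} valid))
      κ∈ : T (memᵇ (κ ∷ κs) κ)
      κ∈ = subst (λ b → T ((κ ≡ᵇ κ) xor b)) (sym κ∉κs) (subst (λ b → T (b xor false)) (sym (≡ᵇ-refl κ)) tt)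
      unflipped-rest : ∀ κ′ → κ′ < 8 → T (memᵇ κs κ′) → own κ′ xor memᵇ (κ ∷ []) κ′ ≡ false
      unflipped-rest κ′ κ′<8 κ′∈ = cong₂ _xor_ (unflipped κ′ κ′<8 (subst (λ b → T (b xor memᵇ κs κ′)) (sym κ′≢κ) κ′∈))
                                          (trans (cong (_xor false) κ′≢κ) refl)
        where
          κ′≢κ : (κ′ ≡ᵇ κ) ≡ false
          κ′≢κ = ≢⇒≡ᵇ-false (λ κ′≡κ → subst T κ∉κs (subst (T ∘ memᵇ κs) κ′≡κ κ′∈))

  record Ready (l c : ℕ) (ps : ParentState) (col : Coloring order) : Set where
    field
      parentCell : ∀ x → level (toℕ x) ≡ l → cell (toℕ x) ≡ c / 8 →
        col x ≡ parentColour ps (kind (toℕ x)) xor twist l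
      subtree : ∀ x → suc l ≤ level (toℕ x) → ancestor (toℕ x) (suc l) ≡ c →
        col x ≡ (isDown (childDir ps) ∧ (level (toℕ x) ≡ᵇ suc l)) xor standard (toℕ x)

  record ChildrenReady (j c : ℕ) (ps : ParentState) (col : Coloring order) : Set where
    field
      ownCell : ∀ x → level (toℕ x) ≡ j → cell (toℕ x) ≡ c →
        col x ≡ parentColour ps (kind (toℕ x)) xor twist j
      below : ∀ x → suc j ≤ level (toℕ x) → ancestor (toℕ x) j ≡ c →
        col x ≡ (isDown (childDir ps) ∧ (level (toℕ x) ≡ᵇ suc j)) xor standard (toℕ x)

  Ready⇒CellState : ∀ {l c ps col} → Ready l c ps col → CellState l c ps (λ _ → false) false col
  Ready⇒CellState {l} {c} {ps} {col} ready = record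
    { parentCell = parentCell
    ; ownCell    = own-cell
    ; belowCell  = λ x below ancestor≡ → trans (subtree x (<⇒≤ below) ancestor≡)
        (cong (_xor standard (toℕ x)) (trans (cong (d ∧_) (≢⇒≡ᵇ-false (<⇒≢ below ∘ sym))) (∧-zeroʳ d)))
    }
    where
      open Ready ready
      open ≡-Reasoning
      open xor-∧-Solver
      d = isDown (childDir ps)
      regroup : ∀ d b t → (d ∧ true) xor (b xor t) ≡ ((d xor b) xor t) xor false
      regroup = solve 3 (λ d b t → (d :* con true) :+ (b :+ t) := ((d :+ b) :+ t) :+ con false) refl
      own-cell : ∀ x → level (toℕ x) ≡ suc l → cell (toℕ x) ≡ c →
        col x ≡ ((d xor baseColour (kind (toℕ x))) xor twist (suc l)) xor false
      own-cell x level≡ cell≡ = begin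
          col x                                                        ≡⟨ subtree x (≤-reflexive (sym level≡)) ancestor≡ ⟩
          (d ∧ (level (toℕ x) ≡ᵇ suc l)) xor (b xor twist (level (toℕ x))) ≡⟨ cong (λ l′ → (d ∧ (l′ ≡ᵇ suc l)) xor (b xor twist l′)) level≡ ⟩
          (d ∧ (suc l ≡ᵇ suc l)) xor (b xor twist (suc l))             ≡⟨ cong (λ e → (d ∧ e) xor (b xor twist (suc l))) (≡ᵇ-refl (suc l)) ⟩
          (d ∧ true) xor (b xor twist (suc l))                         ≡⟨ regroup d b (twist (suc l)) ⟩
          ((d xor b) xor twist (suc l)) xor false                      ∎
        where
          b = baseColour (kind (toℕ x))
          ancestor≡ : ancestor (toℕ x) (suc l) ≡ c
          ancestor≡ = trans (cong (ancestor (toℕ x)) (sym level≡)) (trans (ancestor-self (toℕ x)) cell≡)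

  CellState⇒ChildrenReady : ∀ {l c ps own col} r → (∀ κ → own κ ≡ flippedBefore (childDir ps) r κ) →
    CellState l c ps own (isDown (roundDir r)) col → ChildrenReady (suc l) c (childDir ps , r) col
  CellState⇒ChildrenReady {l} {c} {ps} {own} r own≡ state = record
    { ownCell = λ x level≡ cell≡ → trans (ownCell x level≡ cell≡)
        (trans (cong (((isDown (childDir ps) xor baseColour (kind (toℕ x))) xor twist (suc l)) xor_) (own≡ (kind (toℕ x))))
          (swap (isDown (childDir ps) xor baseColour (kind (toℕ x))) (twist (suc l)) (flippedBefore (childDir ps) r (kind (toℕ x)))))
    ; below   = belowCell
    }
    where
      open CellState state
      open xor-∧-Solver
      swap : ∀ a t f → (a xor t) xor f ≡ (a xor f) xor t
      swap = solve 3 (λ a t f → (a :+ t) :+ f := (a :+ f) :+ t) refl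

  inFirstChildren-outside : ∀ j c k z → k < 8 → suc j ≤ level z → ancestor z (suc j) ≡ 8 * c + k → inFirstChildren j c k z ≡ false
  inFirstChildren-outside j c k z k<8 j<level ancestor≡ with level z ≡ᵇ suc j in e
  ... | false = refl
  ... | true  = trans (cong ((cell z / 8 ≡ᵇ c) ∧_) (>⇒≤ᵇ-false (≤-reflexive (cong suc (sym cell%8))))) (∧-zeroʳ _)
    where
      cell≡ : cell z ≡ 8 * c + k
      cell≡ = trans (sym (ancestor-self z)) (trans (cong (ancestor z) (≡ᵇ⇒≡ (level z) (suc j) (≡true⇒T e))) ancestor≡)
      cell%8 : cell z % 8 ≡ k
      cell%8 = trans (cong (_% 8) cell≡) ([8a+k]%8≡k c k k<8)

  ChildrenReady⇒Ready : ∀ {j c ps col col'} k → k < 8 → ChildrenReady j c ps col →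
    (∀ x → col' x ≡ col x xor inFirstChildren j c k (toℕ x)) → Ready j (8 * c + k) ps col'
  ChildrenReady⇒Ready {j} {c} {ps} {col} {col'} k k<8 ready flip = record
    { parentCell = λ x level≡ cell≡ → trans (unflipped x (inFirstChildren-off x (λ e → 1+n≢n (trans (sym e) level≡))))
        (ownCell x level≡ (trans cell≡ ([8a+k]/8≡a c k k<8)))
    ; subtree    = λ x j<level ancestor≡ → trans (unflipped x (inFirstChildren-outside j c k (toℕ x) k<8 j<level ancestor≡))
        (below x j<level (trans (ancestor-step (toℕ x) j j<level) (trans (cong (_/ 8) ancestor≡) ([8a+k]/8≡a c k k<8))))
    }
    where
      open ChildrenReady ready
      unflipped : ∀ x → inFirstChildren j c k (toℕ x) ≡ false → col' x ≡ col x
      unflipped x off = trans (flip x) (trans (cong (col x xor_) off) (xor-identityʳ (col x)))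
      inFirstChildren-off : ∀ x → ¬ level (toℕ x) ≡ suc j → inFirstChildren j c k (toℕ x) ≡ false
      inFirstChildren-off x level≢ rewrite ≢⇒≡ᵇ-false level≢ = refl

  -- h is the number of levels below the cell.
  mutual
    cellRun : ℕ → ℕ → ℕ → ParentState → List (Fin order)
    cellRun h j c ps = groupsRun j c (preKinds d) ++ childrenRun h j c (d , first) ++ groupsRun j c (midKinds d)
                    ++ childrenRun h j c (d , second) ++ groupsRun j c (postKinds d)
      where d = childDir ps

    childrenRun : ℕ → ℕ → ℕ → ParentState → List (Fin order)
    childrenRun zero    j c ps = []
    childrenRun (suc h) j c ps = firstChildrenRun h j c ps 8

    firstChildrenRun : ℕ → ℕ → ℕ → ParentState → ℕ → List (Fin order)
    firstChildrenRun h j c ps zero    = []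
    firstChildrenRun h j c ps (suc k) = firstChildrenRun h j c ps k ++ cellRun h (suc j) (8 * c + k) ps

  validKinds-schedule : ∀ d → T (validKinds (preKinds d)) × T (validKinds (midKinds d)) × T (validKinds (postKinds d))
  validKinds-schedule up   = tt , tt , tt
  validKinds-schedule down = tt , tt , tt

  mutual
    cellRun-flips : ∀ h l c ps col → suc l + h ≡ H → c < 8 ^ suc l → Ready l c ps col →
      Flips col (cellRun h (suc l) c ps) (inCell (suc l) c)
    cellRun-flips h l c ps col height c< ready =
      Flips-cong (λ z → pre z xor (kids z xor (mid z xor (kids z xor post z)))) (inCell (suc l) c) all-flipped
        (Flips-++ _ _ pre (λ z → kids z xor (mid z xor (kids z xor post z)))
          (groupsRun-flips (preKinds d) ≤H c< (proj₁ valid) (λ _ _ _ → refl) s₀) λ col₁ e₁ →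
         let s₁ = CellState-flipGroups (preKinds d) s₀ e₁ in
         Flips-++ _ _ kids (λ z → mid z xor (kids z xor post z))
          (childrenRun-flips h (suc l) c (d , first) col₁ height c< (CellState⇒ChildrenReady first (λ _ → refl) s₁)) λ col₂ e₂ →
         let s₂ = CellState-flipChildren s₁ e₂ in
         Flips-++ _ _ mid (λ z → kids z xor post z)
          (groupsRun-flips (midKinds d) ≤H c< (proj₁ (proj₂ valid)) (mid-not-pre d) s₂) λ col₃ e₃ →
         let s₃ = CellState-flipGroups (midKinds d) s₂ e₃ in
         Flips-++ _ _ kids post
          (childrenRun-flips h (suc l) c (d , second) col₃ height c< (CellState⇒ChildrenReady second (λ _ → refl) s₃)) λ col₄ e₄ →
         groupsRun-flips (postKinds d) ≤H c< (proj₂ (proj₂ valid)) (post-not-before d) (CellState-flipChildren s₃ e₄))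
      where
        open xor-∧-Solver
        d = childDir ps
        valid = validKinds-schedule d
        pre mid post kids : ℕ → Bool
        pre  = inGroups (suc l) c (preKinds d)
        mid  = inGroups (suc l) c (midKinds d)
        post = inGroups (suc l) c (postKinds d)
        kids = inChildren (suc l) c
        ≤H : suc l ≤ H
        ≤H = subst (suc l ≤_) height (m≤m+n (suc l) h)
        s₀ = Ready⇒CellState ready
        all-flipped : ∀ (x : Fin order) → pre (toℕ x) xor (kids (toℕ x) xor (mid (toℕ x) xor (kids (toℕ x) xor post (toℕ x)))) ≡ inCell (suc l) c (toℕ x)
        all-flipped x = begin
            p xor (k xor (m xor (k xor q)))         ≡⟨ solve 6 (λ L C p′ m′ q′ k → (L :* (C :* p′)) :+ (k :+ ((L :* (C :* m′)) :+ (k :+ (L :* (C :* q′)))))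
                                                                 := L :* (C :* ((p′ :+ m′) :+ q′))) refl L C (memᵇ (preKinds d) κ) (memᵇ (midKinds d) κ) (memᵇ (postKinds d) κ) k ⟩
            L ∧ C ∧ (flippedBefore d second κ xor memᵇ (postKinds d) κ) ≡⟨ cong (λ b → L ∧ C ∧ b) (all-kinds-flipped d κ (kind<8 (toℕ x))) ⟩
            L ∧ C ∧ true                            ≡⟨ cong (L ∧_) (∧-identityʳ C) ⟩
            L ∧ C                                   ∎
          where
            open ≡-Reasoning
            κ = kind (toℕ x)
            L = level (toℕ x) ≡ᵇ suc l
            C = cell (toℕ x) ≡ᵇ c
            p = pre (toℕ x)
            m = mid (toℕ x)
            q = post (toℕ x)
            k = kids (toℕ x)

    childrenRun-flips : ∀ h j c ps col → j + h ≡ H → c < 8 ^ j → ChildrenReady j c ps col →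
      Flips col (childrenRun h j c ps) (inChildren j c)
    childrenRun-flips zero j c ps col height c< ready =
      tt , λ x → sym (trans (cong (col x xor_) (inChildren-off j c (toℕ x) (λ e → 1+n≰n (≤-trans (≤-reflexive (sym e))
                              (≤-trans (level≤H (toℕ x) (toℕ<n x)) (≤-reflexive (trans (sym height) (+-identityʳ j))))))))
                            (xor-identityʳ (col x)))
    childrenRun-flips (suc h) j c ps col height c< ready =
      Flips-cong (inFirstChildren j c 8) (inChildren j c) (λ x → inFirstChildren-8 j c (toℕ x))
        (firstChildrenRun-flips h j c ps col 8 (trans (sym (+-suc j h)) height) c< ≤-refl ready)

    firstChildrenRun-flips : ∀ h j c ps col k → suc j + h ≡ H → c < 8 ^ j → k ≤ 8 → ChildrenReady j c ps col →
      Flips col (firstChildrenRun h j c ps k) (inFirstChildren j c k)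
    firstChildrenRun-flips h j c ps col zero height c< _ ready =
      tt , λ x → sym (trans (cong (col x xor_) (inFirstChildren-zero j c (toℕ x))) (xor-identityʳ (col x)))
    firstChildrenRun-flips h j c ps col (suc k) height c< k<8 ready =
      Flips-cong (λ z → inFirstChildren j c k z xor inCell (suc j) (8 * c + k) z) (inFirstChildren j c (suc k))
        (λ x → sym (inFirstChildren-suc j c k (toℕ x) k<8))
        (Flips-++ _ _ (inFirstChildren j c k) (inCell (suc j) (8 * c + k)) (firstChildrenRun-flips h j c ps col k height c< (<⇒≤ k<8) ready) λ col' flip →
          cellRun-flips h j (8 * c + k) ps col' height (8a+k<8^[1+l] c k j c< k<8) (ChildrenReady⇒Ready k k<8 ready flip))

  -- The single cell of level 0 never switches: it acts as the parent of the level-1 cells,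
  -- shown in the state of the first round of a downward run.
  initialColouring : Coloring order
  initialColouring x = if level (toℕ x) ≡ᵇ 0 then parentColour (down , first) (kind (toℕ x)) xor twist 0 else standard (toℕ x)

  topRun : List (Fin order)
  topRun = childrenRun H 0 0 (down , first)

  topRun-valid : ValidRun 1 3 P graph initialColouring topRun
  topRun-valid = proj₁ (childrenRun-flips H 0 0 (down , first) initialColouring refl (s≤s z≤n) ready)
    where
      ready : ChildrenReady 0 0 (down , first) initialColouring
      ready = record
        { ownCell = λ x level≡ _ → cong (λ l → if l ≡ᵇ 0 then parentColour (down , first) (kind (toℕ x)) xor twist 0 else standard (toℕ x)) level≡
        ; below   = λ x 1≤level _ → cong (λ b → if b then parentColour (down , first) (kind (toℕ x)) xor twist 0 else standard (toℕ x))
                                         (≢⇒≡ᵇ-false (<⇒≢ 1≤level ∘ sym))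
        }

  groupsRun-length : ∀ j c κs → j ≤ H → c < 8 ^ j → T (validKinds κs) → length (groupsRun j c κs) ≡ length κs * groupSize j
  groupsRun-length j c []       _   _  _     = refl
  groupsRun-length j c (κ ∷ κs) j≤H c< valid =
    trans (length-++ (groupRun j c κ))
          (cong₂ _+_ (trans (cong length (proj₂ unfold)) (intervalRun-length _ _ (proj₁ unfold)))
                     (groupsRun-length j c κs j≤H c< (∧-projʳ {not (memᵇ κs κ)} (∧-projʳ {κ <ᵇ 8} valid))))
    where
      unfold = groupRun-unfold j c κ (group-fits j (8 * c + κ) j≤H (8a+k<8^[1+l] c κ j c< (<ᵇ⇒< κ 8 (∧-projˡ valid))))

  -- Every cell of the lowest level flips its 8 groups of size 1 once; each level above
  -- runs all of its 8 child cells twice.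
  mutual
    cellRun-length : ∀ h j c ps → j + h ≡ H → c < 8 ^ j → 8 * 16 ^ h ≤ length (cellRun h j c ps)
    cellRun-length zero j c ps height c< = ≤-reflexive (sym (begin
        length (groupsRun j c (preKinds d) ++ groupsRun j c (midKinds d) ++ groupsRun j c (postKinds d))
          ≡⟨ trans (length-++ (groupsRun j c (preKinds d))) (cong (length (groupsRun j c (preKinds d)) +_) (length-++ (groupsRun j c (midKinds d)))) ⟩
        length (groupsRun j c (preKinds d)) + (length (groupsRun j c (midKinds d)) + length (groupsRun j c (postKinds d)))
          ≡⟨ cong₂ _+_ (groupsRun-length j c (preKinds d) j≤H c< (proj₁ valid))
                       (cong₂ _+_ (groupsRun-length j c (midKinds d) j≤H c< (proj₁ (proj₂ valid))) (groupsRun-length j c (postKinds d) j≤H c< (proj₂ (proj₂ valid)))) ⟩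
        length (preKinds d) * groupSize j + (length (midKinds d) * groupSize j + length (postKinds d) * groupSize j)
          ≡⟨ cong (λ s → length (preKinds d) * s + (length (midKinds d) * s + length (postKinds d) * s)) groupSize-H ⟩
        length (preKinds d) * 1 + (length (midKinds d) * 1 + length (postKinds d) * 1)
          ≡⟨ eight d ⟩
        8 ∎))
      where
        open ≡-Reasoning
        d = childDir ps
        valid = validKinds-schedule d
        j≤H : j ≤ H
        j≤H = subst (j ≤_) height (m≤m+n j 0)
        groupSize-H : groupSize j ≡ 1
        groupSize-H = cong (8 ^_) (trans (cong (_∸ j) (trans (sym height) (+-identityʳ j))) (n∸n≡0 j))
        eight : ∀ d → length (preKinds d) * 1 + (length (midKinds d) * 1 + length (postKinds d) * 1) ≡ 8
        eight up   = refl
        eight down = refl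
    cellRun-length (suc h) j c ps height c< = begin
        8 * 16 ^ suc h                                     ≡⟨ solve 1 (λ t → con 8 :* (con 16 :* t) := con 8 :* (con 8 :* t) :+ con 8 :* (con 8 :* t)) refl (16 ^ h) ⟩
        8 * (8 * 16 ^ h) + 8 * (8 * 16 ^ h)                ≤⟨ +-mono-≤ (firstChildrenRun-length h j c (d , first) 8 height′ c< ≤-refl)
                                                                       (firstChildrenRun-length h j c (d , second) 8 height′ c< ≤-refl) ⟩
        length first-round + length second-round          ≤⟨ +-mono-≤ (m≤n+m _ (length pre)) (≤-trans (m≤m+n _ (length post)) (m≤n+m _ (length mid))) ⟩
        (length pre + length first-round) + (length mid + (length second-round + length post))
          ≡⟨ sym (trans (length-++ pre) (trans (cong (length pre +_) (trans (length-++ first-round)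
               (cong (length first-round +_) (trans (length-++ mid) (cong (length mid +_) (length-++ second-round))))))
               (sym (+-assoc (length pre) _ _)))) ⟩
        length (cellRun (suc h) j c ps)                    ∎
      where
        open ≤-Reasoning
        open +-*-Solver
        d = childDir ps
        pre = groupsRun j c (preKinds d)
        mid = groupsRun j c (midKinds d)
        post = groupsRun j c (postKinds d)
        first-round = childrenRun (suc h) j c (d , first)
        second-round = childrenRun (suc h) j c (d , second)
        height′ : suc j + h ≡ H
        height′ = trans (sym (+-suc j h)) height

    firstChildrenRun-length : ∀ h j c ps k → suc j + h ≡ H → c < 8 ^ j → k ≤ 8 → k * (8 * 16 ^ h) ≤ length (firstChildrenRun h j c ps k)
    firstChildrenRun-length h j c ps zero    height c< _   = z≤n
    firstChildrenRun-length h j c ps (suc k) height c< k<8 = begin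
        suc k * (8 * 16 ^ h)                               ≡⟨ +-comm (8 * 16 ^ h) (k * (8 * 16 ^ h)) ⟩
        k * (8 * 16 ^ h) + 8 * 16 ^ h                      ≤⟨ +-mono-≤ (firstChildrenRun-length h j c ps k height c< (<⇒≤ k<8))
                                                                       (cellRun-length h (suc j) (8 * c + k) ps height (8a+k<8^[1+l] c k j c< k<8)) ⟩
        length (firstChildrenRun h j c ps k) + length (cellRun h (suc j) (8 * c + k) ps)
          ≡⟨ sym (length-++ (firstChildrenRun h j c ps k)) ⟩
        length (firstChildrenRun h j c ps (suc k))         ∎
      where open ≤-Reasoning

  topRun-length : ∀ a → suc a ≡ H → 8 * (8 * 16 ^ a) ≤ length topRun
  topRun-length a height = subst (λ h → 8 * (8 * 16 ^ a) ≤ length (childrenRun h 0 0 (down , first))) height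
                                 (firstChildrenRun-length a 0 0 (down , first) 8 height (s≤s z≤n) ≤-refl)

open Construction using (order; graph; noIsolated)
open Schedule using (initialColouring; topRun; topRun-valid; topRun-length)

[m*n]^k≡m^k*n^k : ∀ m n k → (m * n) ^ k ≡ m ^ k * n ^ k
[m*n]^k≡m^k*n^k m n zero    = refl
[m*n]^k≡m^k*n^k m n (suc k) = trans (cong ((m * n) *_) ([m*n]^k≡m^k*n^k m n k))
  (solve 4 (λ m n x y → (m :* n) :* (x :* y) := (m :* x) :* (n :* y)) refl m n (m ^ k) (n ^ k))
  where open +-*-Solver

order-< : ∀ h → order h < order (suc h)
order-< h = *-mono-< (n<1+n (suc h)) (^-monoʳ-< 8 (s≤s (s≤s z≤n)) (n<1+n (suc h)))

levelFor : ∀ n → order 1 ≤ n → ∃[ a ] (order (suc a) ≤ n × n < order (suc (suc a)))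
levelFor zero    ()
levelFor (suc n) order1≤ with order 1 ≤? n
... | no  order1≰n = 0 , order1≤ , ≤-trans (s≤s (≤-reflexive suc-n≡)) (order-< 1)
  where
    suc-n≡ : suc n ≡ order 1
    suc-n≡ = sym (≤-antisym order1≤ (≰⇒> order1≰n))
... | yes order1≤n with levelFor n order1≤n
...   | a , order≤n , n<order with m≤n⇒m<n∨m≡n n<order
...     | inj₁ suc-n<order = a , m≤n⇒m≤1+n order≤n , suc-n<order
...     | inj₂ suc-n≡order = suc a , ≤-reflexive (sym suc-n≡order) , subst (_< order (suc (suc (suc a)))) (sym suc-n≡order) (order-< (suc (suc a)))

2^[3+a]≤order : ∀ a → 2 ^ (3 + a) ≤ order (suc a)
2^[3+a]≤order a = begin
    2 ^ (3 + a)          ≤⟨ ^-monoʳ-≤ 2 (≤-trans (m≤m+n (3 + a) (3 + 2 * a)) (≤-reflexive (solve 1 (λ a → (con 3 :+ a) :+ (con 3 :+ con 2 :* a) := con 3 :* (con 2 :+ a)) refl a))) ⟩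
    2 ^ (3 * (2 + a))    ≡⟨ sym (^-*-assoc 2 3 (2 + a)) ⟩
    8 ^ (2 + a)          ≤⟨ m≤n*m (8 ^ (2 + a)) (2 + a) ⟩
    order (suc a)        ∎
  where
    open ≤-Reasoning
    open +-*-Solver

8^[3+a]^4≡[64*64*16^a]^3 : ∀ a → (8 ^ (3 + a)) ^ 4 ≡ (64 * (64 * 16 ^ a)) ^ 3
8^[3+a]^4≡[64*64*16^a]^3 zero    = refl
8^[3+a]^4≡[64*64*16^a]^3 (suc a) = begin
    (8 * 8 ^ (3 + a)) ^ 4                  ≡⟨ [m*n]^k≡m^k*n^k 8 (8 ^ (3 + a)) 4 ⟩
    4096 * (8 ^ (3 + a)) ^ 4               ≡⟨ cong (4096 *_) (8^[3+a]^4≡[64*64*16^a]^3 a) ⟩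
    4096 * (64 * (64 * 16 ^ a)) ^ 3        ≡⟨ sym ([m*n]^k≡m^k*n^k 16 (64 * (64 * 16 ^ a)) 3) ⟩
    (16 * (64 * (64 * 16 ^ a))) ^ 3        ≡⟨ cong (_^ 3) (solve 1 (λ t → con 16 :* (con 64 :* (con 64 :* t)) := con 64 :* (con 64 :* (con 16 :* t))) refl (16 ^ a)) ⟩
    (64 * (64 * (16 * 16 ^ a))) ^ 3        ∎
  where
    open ≡-Reasoning
    open +-*-Solver

-- The run has at least 64 · 16^a = 2^(6+4a) switches, while n⁴ < (3 + a)⁴ · 8^(12+4a)
-- and ⌈log₂ n⌉ ≥ 3 + a.
length-bound : ∀ a n len → order (suc a) ≤ n → n < order (suc (suc a)) → 64 * 16 ^ a ≤ len →
  n ^ 4 ≤ (64 * len) ^ 3 * ⌈log₂ n ⌉ ^ (3 * 2)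
length-bound a n len order≤n n<order 64*16^a≤len = begin
    n ^ 4                                    ≤⟨ ^-monoˡ-≤ 4 (<⇒≤ n<order) ⟩
    ((3 + a) * 8 ^ (3 + a)) ^ 4              ≡⟨ [m*n]^k≡m^k*n^k (3 + a) (8 ^ (3 + a)) 4 ⟩
    (3 + a) ^ 4 * (8 ^ (3 + a)) ^ 4          ≡⟨ cong ((3 + a) ^ 4 *_) (8^[3+a]^4≡[64*64*16^a]^3 a) ⟩
    (3 + a) ^ 4 * (64 * (64 * 16 ^ a)) ^ 3   ≤⟨ *-mono-≤ log-bound (^-monoˡ-≤ 3 (*-monoʳ-≤ 64 64*16^a≤len)) ⟩
    L ^ 6 * (64 * len) ^ 3                   ≡⟨ *-comm (L ^ 6) _ ⟩
    (64 * len) ^ 3 * L ^ 6                   ∎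
  where
    open ≤-Reasoning
    L = ⌈log₂ n ⌉
    3+a≤L : 3 + a ≤ L
    3+a≤L = subst (_≤ L) (⌈log₂2^n⌉≡n (3 + a)) (⌈log₂⌉-mono-≤ (≤-trans (2^[3+a]≤order a) order≤n))
    log-bound : (3 + a) ^ 4 ≤ L ^ 6
    log-bound = ≤-trans (^-monoˡ-≤ 4 3+a≤L) (^-monoʳ-≤ L {{>-nonZero (≤-trans (s≤s z≤n) 3+a≤L)}} {4} {6} (s≤s (s≤s (s≤s (s≤s z≤n)))))

lemma10 : (P : Process) →
    ∃[ d ] ∃[ k ] ∃[ N ] (1 ≤ d × (∀ n → n ≥ N →
      ∃[ m ] Σ (Graph m) λ G → Σ (Coloring m) λ col → Σ (List (Fin m)) λ run →
        m ≤ n × NoIsolated G × ValidRun 1 3 P G col run ×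
        n ^ 4 ≤ (d * length run) ^ 3 * ⌈log₂ n ⌉ ^ (3 * k)))
lemma10 P = 64 , 2 , order 1 , s≤s z≤n , construction
  where
    construction : ∀ n → n ≥ order 1 →
      ∃[ m ] Σ (Graph m) λ G → Σ (Coloring m) λ col → Σ (List (Fin m)) λ run →
        m ≤ n × NoIsolated G × ValidRun 1 3 P G col run × n ^ 4 ≤ (64 * length run) ^ 3 * ⌈log₂ n ⌉ ^ (3 * 2)
    construction n order1≤n with levelFor n order1≤n
    ... | a , order≤n , n<order =
      order (suc a) , graph (suc a) , initialColouring (suc a) P , topRun (suc a) P ,
      order≤n , noIsolated (suc a) (s≤s z≤n) , topRun-valid (suc a) P ,
      length-bound a n _ order≤n n<order (≤-trans (≤-reflexive (*-assoc 8 8 (16 ^ a))) (topRun-length (suc a) P a refl))
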